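{- Let $\ell\geq 3$ be an integer, let $G$ be a graph with girth exactly $2\ell$ and no even hole of length at least $2\ell+2$, and let $C$ be an even hole of $G$. Then all short jumps over $C$ of type-e have the same pair of ends.
   Context: A hole is an induced cycle of length at least four; it is even if its length is even. For a hole $C$ and non-adjacent $s,t\in V(C)$, an $(s,t)$-jump over $C$ is an induced $(s,t)$-path $P$ none of whose internal vertices lies in $C$. Let $Q_1,Q_2$ be the two $(s,t)$-paths of $C$. $P$ is short if no internal vertex of $Q_1$ or $Q_2$ is adjacent to an internal vertex of $P$. For a short jump over an even hole, $P\cup Q_1$ and $P\cup Q_2$ have the same parity; $P$ is of type-e if $P\cup Q_1$ is even, and of type-o otherwise. -}

module Defs where

open import Data.Nat using (ℕ; zero; suc; _+_; _*_; _∸_; _≤_; _<_; ∣_-_∣)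
open import Data.Fin using (Fin; toℕ; fromℕ)
open import Data.Product using (Σ; _×_; _,_)
open import Data.Sum using (_⊎_)
open import Data.Empty using (⊥)
open import Relation.Nullary using (¬_)
open import Relation.Binary.PropositionalEquality using (_≡_; _≢_)
open import Function.Definitions using (Injective)
open import Function.Bundles using (_⇔_)

record Graph (n : ℕ) : Set₁ where
  field
    Adj    : Fin n → Fin n → Set
    sym    : ∀ {u v} → Adj u v → Adj v u
    irrefl : ∀ {u} → ¬ Adj u u
open Graph public

Even : ℕ → Set
Even k = Σ ℕ λ m → k ≡ m + m

CycConsec : (k : ℕ) → Fin k → Fin k → Set
CycConsec k i j = (∣ toℕ i - toℕ j ∣ ≡ 1) ⊎ (∣ toℕ i - toℕ j ∣ ≡ k ∸ 1)

record Cycle {n : ℕ} (G : Graph n) (k : ℕ) : Set where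
  field
    three≤k : 3 ≤ k
    vtx     : Fin k → Fin n
    inj     : Injective _≡_ _≡_ vtx
    edges   : ∀ i j → CycConsec k i j → Adj G (vtx i) (vtx j)

record Hole {n : ℕ} (G : Graph n) (k : ℕ) : Set where
  field
    four≤k  : 4 ≤ k
    vtx     : Fin k → Fin n
    inj     : Injective _≡_ _≡_ vtx
    induced : ∀ i j → Adj G (vtx i) (vtx j) ⇔ CycConsec k i j
open Hole public

GirthExactly : {n : ℕ} → Graph n → ℕ → Set
GirthExactly G g = Cycle G g × (∀ k → Cycle G k → g ≤ k)

-- An induced path with L edges (L + 1 vertices) in G.
record InducedPath {n : ℕ} (G : Graph n) (L : ℕ) : Set where
  field
    vtx     : Fin (suc L) → Fin n
    inj     : Injective _≡_ _≡_ vtx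
    induced : ∀ i j → Adj G (vtx i) (vtx j) ⇔ (∣ toℕ i - toℕ j ∣ ≡ 1)
open InducedPath public

Internal : (L : ℕ) → Fin (suc L) → Set
Internal L i = (toℕ i ≢ 0) × (toℕ i ≢ L)

record Jump {n k : ℕ} (G : Graph n) (C : Hole G k) (a b : Fin k) : Set where
  field
    a≢b     : a ≢ b
    nonadj  : ¬ Adj G (vtx C a) (vtx C b)
    len     : ℕ
    path    : InducedPath G len
    start   : vtx path Data.Fin.zero ≡ vtx C a
    end     : vtx path (fromℕ len) ≡ vtx C b
    outside : ∀ i → Internal len i → ∀ c → vtx C c ≢ vtx path i
open Jump public

-- Short: the internal vertices of Q1 and Q2 are exactly the vertices of C other
-- than s and t; none of them is adjacent to an internal vertex of P.
Short : {n k : ℕ} {G : Graph n} {C : Hole G k} {a b : Fin k} → Jump G C a b → Set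
Short {G = G} {C = C} {a} {b} P =
  ∀ c → c ≢ a → c ≢ b → ∀ i → Internal (len P) i → ¬ Adj G (vtx C c) (vtx (path P) i)

-- Type-e: P ∪ Q1 is even, where Q1 is the path of C through positions between a and b,
-- which has ∣ a - b ∣ edges; the cycle P ∪ Q1 has len P + ∣ a - b ∣ vertices.
TypeE : {n k : ℕ} {G : Graph n} {C : Hole G k} {a b : Fin k} → Jump G C a b → Set
TypeE {a = a} {b} P = Even (len P + ∣ toℕ a - toℕ b ∣)

-- Every even hole of G has length exactly 2ℓ: at least the girth, and less than 2ℓ + 2.
-- A short type-e jump P with ends at positions s < t of C closes an even hole with each of
-- the two arcs of C between s and t, so both holes have length 2ℓ; as C itself has length 2ℓ,
-- this forces |P| = t − s = ℓ, i.e. P joins antipodal vertices of C.  Suppose two such jumps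
-- start at positions a and a + x with 0 < x < ℓ.  Applying the girth bound to the cycles they
-- form with arcs of C shows that their interiors are disjoint, and even non-adjacent, since an
-- edge between them would force ℓ ≤ 2.  The two jumps and two arcs of C of equal length m ≥ 1
-- (m = x if x ≤ ℓ − 2, m = ℓ − x if x ≥ 2) then form an even hole of length 2ℓ + 2m, which is
-- impossible.  So all short type-e jumps have the same antipodal pair of ends.

module Submission where

open import Defs hiding (sym)
open import Data.Nat using (ℕ; zero; suc; _+_; _*_; _∸_; _≤_; _<_; z≤n; s≤s; ∣_-_∣; _⊔_; _≤?_; _<?_)
open import Data.Nat.Properties
open import Data.Nat.Tactic.RingSolver using (solve-∀)
open import Data.Nat.Induction using (<-rec)
open import Data.Fin as Fin using (Fin; toℕ)
import Data.Fin.Properties as Fin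
open import Data.Product using (Σ; _×_; _,_; proj₁; proj₂)
open import Data.Sum using (_⊎_; inj₁; inj₂; [_,_]′)
open import Data.Empty using (⊥; ⊥-elim)
open import Relation.Nullary using (¬_; yes; no)
open import Relation.Binary.Definitions using (tri<; tri≈; tri>)
open import Relation.Binary.PropositionalEquality
  using (_≡_; _≢_; refl; sym; trans; cong; cong₂; subst; subst₂; module ≡-Reasoning)
open import Function.Bundles using (mk⇔; Equivalence)

Consecutive : ℕ → ℕ → Set
Consecutive i j = suc i ≡ j ⊎ suc j ≡ i

consecutive-sym : ∀ {i j} → Consecutive i j → Consecutive j i
consecutive-sym (inj₁ p) = inj₂ p
consecutive-sym (inj₂ p) = inj₁ p

∣n-1+n∣≡1 : ∀ n → ∣ n - suc n ∣ ≡ 1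
∣n-1+n∣≡1 zero    = refl
∣n-1+n∣≡1 (suc n) = ∣n-1+n∣≡1 n

consecutive⇒∣m-n∣≡1 : ∀ {i j} → Consecutive i j → ∣ i - j ∣ ≡ 1
consecutive⇒∣m-n∣≡1 {i}     (inj₁ refl) = ∣n-1+n∣≡1 i
consecutive⇒∣m-n∣≡1 {j = j} (inj₂ refl) = trans (∣-∣-comm (suc j) j) (∣n-1+n∣≡1 j)

∣m-n∣≡1⇒consecutive : ∀ i j → ∣ i - j ∣ ≡ 1 → Consecutive i j
∣m-n∣≡1⇒consecutive zero          (suc zero)    refl = inj₁ refl
∣m-n∣≡1⇒consecutive (suc zero)    zero          refl = inj₂ refl
∣m-n∣≡1⇒consecutive (suc i)       (suc j)       e with ∣m-n∣≡1⇒consecutive i j e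
... | inj₁ p = inj₁ (cong suc p)
... | inj₂ p = inj₂ (cong suc p)
∣m-n∣≡1⇒consecutive zero          zero          ()
∣m-n∣≡1⇒consecutive zero          (suc (suc _)) ()
∣m-n∣≡1⇒consecutive (suc (suc _)) zero          ()

Extremes : ℕ → ℕ → ℕ → Set
Extremes N i j = (i ≡ 0 × j ≡ N) ⊎ (j ≡ 0 × i ≡ N)

∣m-n∣≡N⇒extremes : ∀ {N} i j → i ≤ N → j ≤ N → ∣ i - j ∣ ≡ N → Extremes N i j
∣m-n∣≡N⇒extremes zero    j       _   _   e = inj₁ (refl , e)
∣m-n∣≡N⇒extremes (suc i) zero    _   _   e = inj₂ (refl , e)
∣m-n∣≡N⇒extremes (suc i) (suc j) i≤N j≤N refl =
  ⊥-elim (1+n≰n (≤-trans (s≤s (∣m-n∣≤m⊔n i j)) (⊔-lub i≤N j≤N)))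

extremes⇒∣m-n∣≡N : ∀ {N i j} → Extremes N i j → ∣ i - j ∣ ≡ N
extremes⇒∣m-n∣≡N         (inj₁ (refl , refl)) = refl
extremes⇒∣m-n∣≡N {N = N} (inj₂ (refl , refl)) = ∣-∣-identityʳ N

consecutive-+ˡ⁻ : ∀ s {i j} → Consecutive (s + i) (s + j) → Consecutive i j
consecutive-+ˡ⁻ s (inj₁ p) = inj₁ (+-cancelˡ-≡ s _ _ (trans (+-suc s _) p))
consecutive-+ˡ⁻ s (inj₂ p) = inj₂ (+-cancelˡ-≡ s _ _ (trans (+-suc s _) p))

consecutive-+ˡ⁺ : ∀ s {i j} → Consecutive i j → Consecutive (s + i) (s + j)
consecutive-+ˡ⁺ s (inj₁ refl) = inj₁ (sym (+-suc s _))
consecutive-+ˡ⁺ s (inj₂ refl) = inj₂ (sym (+-suc s _))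

L∸i≡1+[L∸1+i] : ∀ {L i} → i < L → L ∸ i ≡ suc (L ∸ suc i)
L∸i≡1+[L∸1+i] = +-∸-assoc 1

L∸1+i<L : ∀ {L i} → i < L → L ∸ suc i < L
L∸1+i<L = ∸-monoʳ-< (s≤s z≤n)

interior-reverse : ∀ {L i} → 0 < i → i < L → 0 < L ∸ i × L ∸ i < L
interior-reverse {L} {suc i} _ i<L = m<n⇒0<n∸m i<L , L∸1+i<L (<⇒≤ i<L)

1+[L∸i]≡L∸j⇒1+j≡i : ∀ {L i j} → i ≤ L → j ≤ L → suc (L ∸ i) ≡ L ∸ j → suc j ≡ i
1+[L∸i]≡L∸j⇒1+j≡i {L} {i} {j} i≤L j≤L e =
  sym (∸-cancelˡ-≡ i≤L j<L (suc-injective (trans e (L∸i≡1+[L∸1+i] j<L))))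
  where
  j<L : j < L
  j<L = m∸n≢0⇒n<m (λ L∸j≡0 → 1+n≢0 (trans e L∸j≡0))

consecutive-∸ˡ⁻ : ∀ L {i j} → i ≤ L → j ≤ L → Consecutive (L ∸ i) (L ∸ j) → Consecutive i j
consecutive-∸ˡ⁻ L i≤L j≤L (inj₁ e) = inj₂ (1+[L∸i]≡L∸j⇒1+j≡i i≤L j≤L e)
consecutive-∸ˡ⁻ L i≤L j≤L (inj₂ e) = inj₁ (1+[L∸i]≡L∸j⇒1+j≡i j≤L i≤L e)

data Split (L i : ℕ) : Set where
  ≤-part : i ≤ L → Split L i
  >-part : ∀ j → i ≡ L + suc j → Split L i

split : ∀ L i → Split L i
split L i with i ≤? L
... | yes i≤L = ≤-part i≤L
... | no  i≰L = >-part (i ∸ suc L) (sym (trans (+-suc L _) (m+[n∸m]≡n (≰⇒> i≰L))))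

>-part-bound : ∀ {L M j} → L + suc j ≤ L + M → suc j ≤ M
>-part-bound {L} = +-cancelˡ-≤ L _ _

2*n≡n+n : ∀ n → 2 * n ≡ n + n
2*n≡n+n n = cong (n +_) (+-identityʳ n)

n+n-cancel-≤ : ∀ {a b} → a + a ≤ b + b → a ≤ b
n+n-cancel-≤ {a} {b} le = subst₂ _≤_ (sym (n≡⌊n+n/2⌋ a)) (sym (n≡⌊n+n/2⌋ b)) (⌊n/2⌋-mono le)

n+n-injective : ∀ {a b} → a + a ≡ b + b → a ≡ b
n+n-injective e = ≤-antisym (n+n-cancel-≤ (≤-reflexive e)) (n+n-cancel-≤ (≤-reflexive (sym e)))

even-pinched : ∀ {ℓ m} → Even m → ℓ + ℓ ≤ m → m < suc ℓ + suc ℓ → m ≡ ℓ + ℓ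
even-pinched {ℓ} (q , refl) lower upper =
  cong (λ k → k + k) (≤-antisym {q} {ℓ} (≮⇒≥ (λ ℓ<q → <⇒≱ upper (+-mono-≤ ℓ<q ℓ<q))) (n+n-cancel-≤ lower))

x+[1+d+1+d] : ∀ x d → x + (suc d + suc d) ≡ suc (suc (x + (d + d)))
x+[1+d+1+d] = solve-∀

even-cancel-double : ∀ x d {y} → x + (d + d) ≡ y + y → Even x
even-cancel-double x zero    {y}     e = y , trans (sym (+-identityʳ x)) e
even-cancel-double x (suc d) {zero}  e = ⊥-elim (1+n≢0 (trans (sym (x+[1+d+1+d] x d)) e))
even-cancel-double x (suc d) {suc y} e =
  even-cancel-double x d {y} (suc-injective (suc-injective (trans (sym (x+[1+d+1+d] x d)) (trans e (cong suc (+-suc y y))))))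

complementary-bounds⇒≤ : ∀ {ℓ m j y} → j ≤ ℓ → y ≤ ℓ →
                         ℓ + ℓ ≤ m + (j + y) → ℓ + ℓ ≤ m + ((ℓ ∸ j) + (ℓ ∸ y)) → ℓ ≤ m
complementary-bounds⇒≤ {ℓ} {m} {j} {y} j≤ℓ y≤ℓ cycle₁ cycle₂ =
  n+n-cancel-≤ (+-cancelʳ-≤ (ℓ + ℓ) (ℓ + ℓ) (m + m)
    (subst ((ℓ + ℓ) + (ℓ + ℓ) ≤_) total (+-mono-≤ cycle₁ cycle₂)))
  where
  regroup : ∀ m j y a b → (m + (j + y)) + (m + (a + b)) ≡ (m + m) + ((j + a) + (y + b))
  regroup = solve-∀
  total : (m + (j + y)) + (m + ((ℓ ∸ j) + (ℓ ∸ y))) ≡ (m + m) + (ℓ + ℓ)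
  total = trans (regroup m j y (ℓ ∸ j) (ℓ ∸ y))
                (cong ((m + m) +_) (cong₂ _+_ (m+[n∸m]≡n j≤ℓ) (m+[n∸m]≡n y≤ℓ)))

Neighbours : ℕ → ℕ → ℕ → Set
Neighbours N i j = Consecutive i j ⊎ Extremes N i j

neighbours-sym : ∀ {N i j} → Neighbours N i j → Neighbours N j i
neighbours-sym (inj₁ c)        = inj₁ (consecutive-sym c)
neighbours-sym (inj₂ (inj₁ e)) = inj₂ (inj₂ e)
neighbours-sym (inj₂ (inj₂ e)) = inj₂ (inj₁ e)

neighbours⇒cycConsec : ∀ {N} (x y : Fin (suc N)) → Neighbours N (toℕ x) (toℕ y) → CycConsec (suc N) x y
neighbours⇒cycConsec x y (inj₁ c) = inj₁ (consecutive⇒∣m-n∣≡1 c)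
neighbours⇒cycConsec x y (inj₂ e) = inj₂ (extremes⇒∣m-n∣≡N e)

cycConsec⇒neighbours : ∀ {N} (x y : Fin (suc N)) → CycConsec (suc N) x y → Neighbours N (toℕ x) (toℕ y)
cycConsec⇒neighbours x y (inj₁ e) = inj₁ (∣m-n∣≡1⇒consecutive _ _ e)
cycConsec⇒neighbours x y (inj₂ e) = inj₂ (∣m-n∣≡N⇒extremes _ _ (Fin.toℕ≤pred[n] x) (Fin.toℕ≤pred[n] y) e)

Separated : ℕ → ℕ → ℕ → Set
Separated K c d = c ≢ d × ¬ Neighbours K c d

separated-sym : ∀ {K c d} → Separated K c d → Separated K d c
separated-sym (c≢d , ¬nb) = (λ e → c≢d (sym e)) , (λ nb → ¬nb (neighbours-sym nb))

gap⇒separated : ∀ {K c d} → suc (suc c) ≤ d → 0 < c ⊎ d < K → Separated K c d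
gap⇒separated {K} {c} {d} c+2≤d notExtremes = <⇒≢ c<d , ¬nb
  where
  c<d : c < d
  c<d = ≤-trans (n≤1+n (suc c)) c+2≤d
  ¬nb : ¬ Neighbours K c d
  ¬nb (inj₁ (inj₁ refl))        = 1+n≰n c+2≤d
  ¬nb (inj₁ (inj₂ refl))        = 1+n≰n (≤-trans (n≤1+n (suc d)) c<d)
  ¬nb (inj₂ (inj₁ (refl , refl))) = [ (λ ()) , <-irrefl refl ]′ notExtremes
  ¬nb (inj₂ (inj₂ (refl , _)))  = <⇒≱ c<d z≤n

¬extremes⇒ : ∀ {K} s {t} → t ≤ K → ¬ Extremes K s t → 0 < s ⊎ t < K
¬extremes⇒ (suc _) _   _    = inj₁ (s≤s z≤n)
¬extremes⇒ zero    t≤K ¬ext with m≤n⇒m<n∨m≡n t≤K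
... | inj₁ t<K = inj₂ t<K
... | inj₂ t≡K = ⊥-elim (¬ext (inj₁ (refl , t≡K)))

¬neighbours⇒gap : ∀ {K s t} → s < t → t ≤ K → ¬ Neighbours K s t → suc (suc s) ≤ t × (0 < s ⊎ t < K)
¬neighbours⇒gap {K} {s} {t} s<t t≤K ¬nb = s+2≤t , ¬extremes⇒ s t≤K (λ ext → ¬nb (inj₂ ext))
  where
  s+2≤t : suc (suc s) ≤ t
  s+2≤t with m≤n⇒m<n∨m≡n s<t
  ... | inj₁ 1+s<t = 1+s<t
  ... | inj₂ 1+s≡t = ⊥-elim (¬nb (inj₁ (inj₁ 1+s≡t)))

-- Positions beyond K are sent to the junk value zero.
position : ∀ {K} → ℕ → Fin (suc K)
position {K} c with c <? suc K
... | yes c<1+K = Fin.fromℕ< c<1+K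
... | no  _     = Fin.zero

toℕ-position : ∀ {K c} → c ≤ K → toℕ (position {K} c) ≡ c
toℕ-position {K} {c} c≤K with c <? suc K
... | yes c<1+K = Fin.toℕ-fromℕ< c<1+K
... | no  c≮1+K = ⊥-elim (c≮1+K (s≤s c≤K))

position-toℕ : ∀ {K} (x : Fin (suc K)) → position (toℕ x) ≡ x
position-toℕ x = Fin.toℕ-injective (toℕ-position (Fin.toℕ≤pred[n] x))

module Walks {n : ℕ} (G : Graph n) where

  V : Set
  V = Fin n

  _~_ : V → V → Set
  _~_ = Adj G

  ~-sym : ∀ {u v} → u ~ v → v ~ u
  ~-sym = Graph.sym G

  InjectiveUpTo : (ℕ → V) → ℕ → Set
  InjectiveUpTo f L = ∀ i j → i ≤ L → j ≤ L → f i ≡ f j → i ≡ j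

  -- A path of length L is a sequence f : ℕ → V of which only f 0, …, f L matter.
  record IsPath (f : ℕ → V) (L : ℕ) : Set where
    constructor mkPath
    field
      injective : InjectiveUpTo f L
      step      : ∀ i → i < L → f i ~ f (suc i)
  open IsPath public

  record IsInducedPath (f : ℕ → V) (L : ℕ) : Set where
    constructor mkInducedPath
    field
      isPath    : IsPath f L
      chordless : ∀ i j → i ≤ L → j ≤ L → f i ~ f j → Consecutive i j
  open IsInducedPath public

  consecutive⇒adjacent : ∀ {f L} → IsPath f L → ∀ i j → i ≤ L → j ≤ L → Consecutive i j → f i ~ f j
  consecutive⇒adjacent p i _ _   j≤L (inj₁ refl) = step p i j≤L
  consecutive⇒adjacent p _ j i≤L _   (inj₂ refl) = ~-sym (step p j i≤L)

  inducedPath⇒isInducedPath : ∀ {L} (Q : InducedPath G L) → IsInducedPath (λ i → vtx Q (position i)) L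
  inducedPath⇒isInducedPath {L} Q = mkInducedPath (mkPath injective′ step′) chordless′
    where
    toℕ-pos = toℕ-position {L}
    injective′ : InjectiveUpTo (λ i → vtx Q (position i)) L
    injective′ i j i≤L j≤L e = trans (sym (toℕ-pos i≤L)) (trans (cong toℕ (inj Q e)) (toℕ-pos j≤L))
    step′ : ∀ i → i < L → vtx Q (position i) ~ vtx Q (position (suc i))
    step′ i i<L = Equivalence.from (induced Q _ _)
      (subst₂ (λ x y → ∣ x - y ∣ ≡ 1) (sym (toℕ-pos (<⇒≤ i<L))) (sym (toℕ-pos i<L)) (∣n-1+n∣≡1 i))
    chordless′ : ∀ i j → i ≤ L → j ≤ L → vtx Q (position i) ~ vtx Q (position j) → Consecutive i j
    chordless′ i j i≤L j≤L a = ∣m-n∣≡1⇒consecutive i j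
      (subst₂ (λ x y → ∣ x - y ∣ ≡ 1) (toℕ-pos i≤L) (toℕ-pos j≤L) (Equivalence.to (induced Q _ _) a))

  isPath-prefix : ∀ {f L M} → M ≤ L → IsPath f L → IsPath f M
  isPath-prefix M≤L (mkPath inj stp) =
    mkPath (λ i j i≤ j≤ → inj i j (≤-trans i≤ M≤L) (≤-trans j≤ M≤L)) (λ i i< → stp i (≤-trans i< M≤L))

  isInducedPath-prefix : ∀ {f L M} → M ≤ L → IsInducedPath f L → IsInducedPath f M
  isInducedPath-prefix M≤L (mkInducedPath p ch) =
    mkInducedPath (isPath-prefix M≤L p) (λ i j i≤ j≤ → ch i j (≤-trans i≤ M≤L) (≤-trans j≤ M≤L))

  shift : ℕ → (ℕ → V) → ℕ → V
  shift s f i = f (s + i)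

  isPath-shift : ∀ {f L} s M → s + M ≤ L → IsPath f L → IsPath (shift s f) M
  isPath-shift {f} {L} s M s+M≤L (mkPath inj stp) = mkPath
    (λ i j i≤ j≤ e → +-cancelˡ-≡ s i j (inj (s + i) (s + j) (bound i≤) (bound j≤) e))
    (λ i i< → subst (λ k → f (s + i) ~ f k) (sym (+-suc s i))
                (stp (s + i) (≤-trans (≤-reflexive (sym (+-suc s i))) (bound i<))))
    where
    bound : ∀ {i} → i ≤ M → s + i ≤ L
    bound i≤M = ≤-trans (+-monoʳ-≤ s i≤M) s+M≤L

  reverse : ℕ → (ℕ → V) → ℕ → V
  reverse L f i = f (L ∸ i)

  isPath-reverse : ∀ {f L} → IsPath f L → IsPath (reverse L f) L
  isPath-reverse {f} {L} (mkPath inj stp) = mkPath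
    (λ i j i≤ j≤ e → ∸-cancelˡ-≡ i≤ j≤ (inj (L ∸ i) (L ∸ j) (m∸n≤m L i) (m∸n≤m L j) e))
    (λ i i< → ~-sym (subst (λ k → f (L ∸ suc i) ~ f k) (sym (L∸i≡1+[L∸1+i] i<)) (stp (L ∸ suc i) (L∸1+i<L i<))))

  isInducedPath-reverse : ∀ {f L} → IsInducedPath f L → IsInducedPath (reverse L f) L
  isInducedPath-reverse {f} {L} (mkInducedPath p ch) = mkInducedPath (isPath-reverse p)
    (λ i j i≤ j≤ a → consecutive-∸ˡ⁻ L i≤ j≤ (ch (L ∸ i) (L ∸ j) (m∸n≤m L i) (m∸n≤m L j) a))

  join : (ℕ → V) → ℕ → (ℕ → V) → ℕ → V
  join f L g i with i ≤? L
  ... | yes _ = f i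
  ... | no  _ = g (i ∸ L)

  join-≤ : ∀ f L g {i} → i ≤ L → join f L g i ≡ f i
  join-≤ f L g {i} i≤L with i ≤? L
  ... | yes _   = refl
  ... | no  i≰L = ⊥-elim (i≰L i≤L)

  join-> : ∀ f L g {i} → L < i → join f L g i ≡ g (i ∸ L)
  join-> f L g {i} L<i with i ≤? L
  ... | yes i≤L = ⊥-elim (<⇒≱ L<i i≤L)
  ... | no  _   = refl

  join-+ : ∀ f L g → f L ≡ g 0 → ∀ j → join f L g (L + j) ≡ g j
  join-+ f L g fL≡g0 zero    = trans (join-≤ f L g (≤-reflexive (+-identityʳ L)))
                                     (trans (cong f (+-identityʳ L)) fL≡g0)
  join-+ f L g _     (suc j) = trans (join-> f L g (m<m+n L (s≤s z≤n))) (cong g (m+n∸m≡n L (suc j)))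

  join-interior : ∀ f L g → f L ≡ g 0 → ∀ {M r} → r < L + M →
                  (r < L × join f L g r ≡ f r) ⊎ (Σ ℕ λ q → q < M × join f L g r ≡ g q)
  join-interior f L g fL≡g0 {M} {r} r< with <-≤-connex r L
  ... | inj₁ r<L = inj₁ (r<L , join-≤ f L g (<⇒≤ r<L))
  ... | inj₂ L≤r with m≤n⇒∃[o]m+o≡n L≤r
  ...   | q , refl = inj₂ (q , +-cancelˡ-< L _ _ r< , join-+ f L g fL≡g0 q)

  JoinDisjoint : (ℕ → V) → ℕ → (ℕ → V) → ℕ → Set
  JoinDisjoint f L g M = ∀ i j → i < L → 0 < j → j ≤ M → f i ≢ g j

  JoinNonAdjacent : (ℕ → V) → ℕ → (ℕ → V) → ℕ → Set
  JoinNonAdjacent f L g M = ∀ i j → i < L → 0 < j → j ≤ M → ¬ f i ~ g j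

  isPath-join : ∀ {f g L M} → IsPath f L → IsPath g M → f L ≡ g 0 → JoinDisjoint f L g M →
                IsPath (join f L g) (L + M)
  isPath-join {f} {g} {L} {M} fp gp fL≡g0 disj = mkPath injective′ step′
    where
    f≢g : ∀ i j → i ≤ L → suc j ≤ M → f i ≢ g (suc j)
    f≢g i j i≤L j<M with m≤n⇒m<n∨m≡n i≤L
    ... | inj₁ i<L = disj i (suc j) i<L (s≤s z≤n) j<M
    ... | inj₂ refl = λ e → 0≢1+n (injective gp 0 (suc j) z≤n j<M (trans (sym fL≡g0) e))
    injective′ : InjectiveUpTo (join f L g) (L + M)
    injective′ i j i≤ j≤ e with split L i | split L j
    ... | ≤-part i≤L | ≤-part j≤L =
      injective fp i j i≤L j≤L (trans (sym (join-≤ f L g i≤L)) (trans e (join-≤ f L g j≤L)))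
    ... | >-part a refl | >-part b refl = cong (λ k → L + suc k) (suc-injective
      (injective gp (suc a) (suc b) (>-part-bound i≤) (>-part-bound j≤)
        (trans (sym (join-+ f L g fL≡g0 (suc a))) (trans e (join-+ f L g fL≡g0 (suc b))))))
    ... | ≤-part i≤L | >-part b refl = ⊥-elim (f≢g i b i≤L (>-part-bound j≤)
      (trans (sym (join-≤ f L g i≤L)) (trans e (join-+ f L g fL≡g0 (suc b)))))
    ... | >-part a refl | ≤-part j≤L = ⊥-elim (f≢g j a j≤L (>-part-bound i≤)
      (trans (sym (join-≤ f L g j≤L)) (trans (sym e) (join-+ f L g fL≡g0 (suc a)))))
    step′ : ∀ i → i < L + M → join f L g i ~ join f L g (suc i)
    step′ i i< with <-≤-connex i L
    ... | inj₁ i<L = subst₂ _~_ (sym (join-≤ f L g (<⇒≤ i<L))) (sym (join-≤ f L g i<L)) (step fp i i<L)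
    ... | inj₂ L≤i with m≤n⇒∃[o]m+o≡n L≤i
    ...   | d , refl = subst₂ _~_ (sym (join-+ f L g fL≡g0 d))
                         (trans (sym (join-+ f L g fL≡g0 (suc d))) (cong (join f L g) (+-suc L d)))
                         (step gp d (+-cancelˡ-< L _ _ i<))

  isInducedPath-join : ∀ {f g L M} → IsInducedPath f L → IsInducedPath g M → f L ≡ g 0 →
                       JoinDisjoint f L g M → JoinNonAdjacent f L g M → IsInducedPath (join f L g) (L + M)
  isInducedPath-join {f} {g} {L} {M} (mkInducedPath fp fch) (mkInducedPath gp gch) fL≡g0 disj nonadj =
    mkInducedPath (isPath-join fp gp fL≡g0 disj) chordless′
    where
    across : ∀ i j → i ≤ L → suc j ≤ M → f i ~ g (suc j) → Consecutive i (L + suc j)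
    across i j i≤L j<M a with m≤n⇒m<n∨m≡n i≤L
    ... | inj₁ i<L = ⊥-elim (nonadj i (suc j) i<L (s≤s z≤n) j<M a)
    ... | inj₂ refl with gch 0 (suc j) z≤n j<M (subst (_~ g (suc j)) fL≡g0 a)
    ...   | inj₁ refl = inj₁ (+-comm 1 i)
    chordless′ : ∀ i j → i ≤ L + M → j ≤ L + M → join f L g i ~ join f L g j → Consecutive i j
    chordless′ i j i≤ j≤ a with split L i | split L j
    ... | ≤-part i≤L | ≤-part j≤L = fch i j i≤L j≤L (subst₂ _~_ (join-≤ f L g i≤L) (join-≤ f L g j≤L) a)
    ... | >-part c refl | >-part d refl = consecutive-+ˡ⁺ L (gch (suc c) (suc d) (>-part-bound i≤) (>-part-bound j≤)
      (subst₂ _~_ (join-+ f L g fL≡g0 (suc c)) (join-+ f L g fL≡g0 (suc d)) a))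
    ... | ≤-part i≤L | >-part d refl =
      across i d i≤L (>-part-bound j≤) (subst₂ _~_ (join-≤ f L g i≤L) (join-+ f L g fL≡g0 (suc d)) a)
    ... | >-part c refl | ≤-part j≤L = consecutive-sym (across j c j≤L (>-part-bound i≤)
      (~-sym (subst₂ _~_ (join-+ f L g fL≡g0 (suc c)) (join-≤ f L g j≤L) a)))

  sequence⇒cycle : ∀ {h N} → 2 ≤ N → InjectiveUpTo h N →
                   (∀ i j → i ≤ N → j ≤ N → Neighbours N i j → h i ~ h j) → Cycle G (suc N)
  sequence⇒cycle {h} 2≤N inj adj = record
    { three≤k = s≤s 2≤N
    ; vtx     = λ x → h (toℕ x)
    ; inj     = λ {x} {y} e → Fin.toℕ-injective (inj _ _ (Fin.toℕ≤pred[n] x) (Fin.toℕ≤pred[n] y) e)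
    ; edges   = λ x y c → adj _ _ (Fin.toℕ≤pred[n] x) (Fin.toℕ≤pred[n] y) (cycConsec⇒neighbours x y c)
    }

  sequence⇒hole : ∀ {h N} → 3 ≤ N → InjectiveUpTo h N →
                  (∀ i j → i ≤ N → j ≤ N → h i ~ h j → Neighbours N i j) →
                  (∀ i j → i ≤ N → j ≤ N → Neighbours N i j → h i ~ h j) → Hole G (suc N)
  sequence⇒hole {h} 3≤N inj adj⇒nb nb⇒adj = record
    { four≤k  = s≤s 3≤N
    ; vtx     = λ x → h (toℕ x)
    ; inj     = λ {x} {y} e → Fin.toℕ-injective (inj _ _ (Fin.toℕ≤pred[n] x) (Fin.toℕ≤pred[n] y) e)
    ; induced = λ x y → mk⇔
        (λ a → neighbours⇒cycConsec x y (adj⇒nb _ _ (Fin.toℕ≤pred[n] x) (Fin.toℕ≤pred[n] y) a))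
        (λ c → nb⇒adj _ _ (Fin.toℕ≤pred[n] x) (Fin.toℕ≤pred[n] y) (cycConsec⇒neighbours x y c))
    }

  closedPath⇒cycle : ∀ {Z M} → IsPath Z M → 2 ≤ M → Z M ~ Z 0 → Cycle G (suc M)
  closedPath⇒cycle {Z} {M} p 2≤M closing = sequence⇒cycle 2≤M (injective p) adjacent
    where
    adjacent : ∀ i j → i ≤ M → j ≤ M → Neighbours M i j → Z i ~ Z j
    adjacent i j i≤M j≤M (inj₁ c)                  = consecutive⇒adjacent p i j i≤M j≤M c
    adjacent _ _ _   _   (inj₂ (inj₁ (refl , refl))) = ~-sym closing
    adjacent _ _ _   _   (inj₂ (inj₂ (refl , refl))) = closing

  apex⇒hole : ∀ {Z M} → IsInducedPath Z M → 2 ≤ M → (w : V) → (∀ i → i ≤ M → Z i ≢ w) →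
              w ~ Z 0 → w ~ Z M → (∀ i → 0 < i → i < M → ¬ w ~ Z i) → Hole G (suc (suc M))
  apex⇒hole {Z} {M} ip 2≤M w w∉Z w~Z0 w~ZM w≁Z = sequence⇒hole (s≤s 2≤M) h-injective adj⇒nb nb⇒adj
    where
    h : ℕ → V
    h = join Z M (λ _ → w)
    onPath : ∀ {i} → i ≤ M → h i ≡ Z i
    onPath = join-≤ Z M _
    atApex : h (suc M) ≡ w
    atApex = join-> Z M _ ≤-refl
    pathOrApex : ∀ {i} → i ≤ suc M → i ≤ M ⊎ i ≡ suc M
    pathOrApex i≤ with m≤n⇒m<n∨m≡n i≤
    ... | inj₁ i<1+M = inj₁ (≤-pred i<1+M)
    ... | inj₂ i≡1+M = inj₂ i≡1+M
    h-injective : InjectiveUpTo h (suc M)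
    h-injective i j i≤ j≤ e with pathOrApex i≤ | pathOrApex j≤
    ... | inj₁ i≤M | inj₁ j≤M = injective (isPath ip) i j i≤M j≤M (trans (sym (onPath i≤M)) (trans e (onPath j≤M)))
    ... | inj₁ i≤M | inj₂ refl = ⊥-elim (w∉Z i i≤M (trans (sym (onPath i≤M)) (trans e atApex)))
    ... | inj₂ refl | inj₁ j≤M = ⊥-elim (w∉Z j j≤M (trans (sym (onPath j≤M)) (trans (sym e) atApex)))
    ... | inj₂ refl | inj₂ refl = refl
    toApex : ∀ i → i ≤ M → Z i ~ w → Neighbours (suc M) i (suc M)
    toApex zero    _   _ = inj₂ (inj₁ (refl , refl))
    toApex (suc i) i<M a with m≤n⇒m<n∨m≡n i<M
    ... | inj₁ 1+i<M = ⊥-elim (w≁Z (suc i) (s≤s z≤n) 1+i<M (~-sym a))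
    ... | inj₂ refl  = inj₁ (inj₁ refl)
    fromApex : ∀ i → i ≤ M → Neighbours (suc M) i (suc M) → Z i ~ w
    fromApex i i≤M (inj₁ (inj₁ refl))        = ~-sym w~ZM
    fromApex i i≤M (inj₁ (inj₂ refl))        = ⊥-elim (<⇒≱ (s≤s (n≤1+n M)) i≤M)
    fromApex i i≤M (inj₂ (inj₁ (refl , _))) = ~-sym w~Z0
    fromApex i i≤M (inj₂ (inj₂ ()))
    adj⇒nb : ∀ i j → i ≤ suc M → j ≤ suc M → h i ~ h j → Neighbours (suc M) i j
    adj⇒nb i j i≤ j≤ a with pathOrApex i≤ | pathOrApex j≤
    ... | inj₁ i≤M | inj₁ j≤M = inj₁ (chordless ip i j i≤M j≤M (subst₂ _~_ (onPath i≤M) (onPath j≤M) a))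
    ... | inj₁ i≤M | inj₂ refl = toApex i i≤M (subst₂ _~_ (onPath i≤M) atApex a)
    ... | inj₂ refl | inj₁ j≤M = neighbours-sym (toApex j j≤M (~-sym (subst₂ _~_ atApex (onPath j≤M) a)))
    ... | inj₂ refl | inj₂ refl = ⊥-elim (Graph.irrefl G a)
    nb⇒adj : ∀ i j → i ≤ suc M → j ≤ suc M → Neighbours (suc M) i j → h i ~ h j
    nb⇒adj i j i≤ j≤ nb with pathOrApex i≤ | pathOrApex j≤
    nb⇒adj i j i≤ j≤ (inj₁ c) | inj₁ i≤M | inj₁ j≤M =
      subst₂ _~_ (sym (onPath i≤M)) (sym (onPath j≤M)) (consecutive⇒adjacent (isPath ip) i j i≤M j≤M c)
    nb⇒adj i j i≤ j≤ (inj₂ (inj₁ (_ , refl))) | inj₁ _ | inj₁ j≤M = ⊥-elim (1+n≰n j≤M)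
    nb⇒adj i j i≤ j≤ (inj₂ (inj₂ (_ , refl))) | inj₁ i≤M | inj₁ _ = ⊥-elim (1+n≰n i≤M)
    ... | inj₁ i≤M | inj₂ refl = subst₂ _~_ (sym (onPath i≤M)) (sym atApex) (fromApex i i≤M nb)
    ... | inj₂ refl | inj₁ j≤M =
      subst₂ _~_ (sym atApex) (sym (onPath j≤M)) (~-sym (fromApex j j≤M (neighbours-sym nb)))
    nb⇒adj _ _ _ _ (inj₁ (inj₁ e)) | inj₂ refl | inj₂ refl = ⊥-elim (1+n≢n e)
    nb⇒adj _ _ _ _ (inj₁ (inj₂ e)) | inj₂ refl | inj₂ refl = ⊥-elim (1+n≢n e)
    nb⇒adj _ _ _ _ (inj₂ (inj₁ ())) | inj₂ refl | inj₂ refl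
    nb⇒adj _ _ _ _ (inj₂ (inj₂ ())) | inj₂ refl | inj₂ refl

  InteriorsDisjoint : (ℕ → V) → ℕ → (ℕ → V) → ℕ → Set
  InteriorsDisjoint X L Y M = ∀ i j → 0 < i → i < L → 0 < j → j < M → X i ≢ Y j

  InteriorsNonAdjacent : (ℕ → V) → ℕ → (ℕ → V) → ℕ → Set
  InteriorsNonAdjacent X L Y M = ∀ i j → 0 < i → i < L → 0 < j → j < M → ¬ X i ~ Y j

  twoPaths⇒cycle : ∀ {X Y L M} → IsPath X L → IsPath Y M → 1 ≤ L → 1 ≤ M → 3 ≤ L + M →
                   X L ≡ Y 0 → Y M ≡ X 0 → InteriorsDisjoint X L Y M → Cycle G (L + M)
  twoPaths⇒cycle {M = zero} _ _ _ () _ _ _ _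
  twoPaths⇒cycle {X} {Y} {L} {suc M} px py 1≤L _ 3≤ XL≡Y0 YM≡X0 disj =
    subst (Cycle G) (sym (+-suc L M)) (closedPath⇒cycle (isPath-join px (isPath-prefix (n≤1+n M) py) XL≡Y0 disj′)
      (≤-pred (subst (3 ≤_) (+-suc L M) 3≤)) closing)
    where
    disj′ : JoinDisjoint X L Y M
    disj′ zero    j _   0<j j≤M e = 1+n≰n (≤-trans (s≤s j≤M) (≤-reflexive
      (injective py (suc M) j ≤-refl (m≤n⇒m≤1+n j≤M) (trans YM≡X0 e))))
    disj′ (suc i) j i<L 0<j j≤M = disj (suc i) j (s≤s z≤n) i<L 0<j (s≤s j≤M)
    closing : join X L Y (L + M) ~ join X L Y 0
    closing = subst₂ _~_ (sym (join-+ X L Y XL≡Y0 M)) (trans YM≡X0 (sym (join-≤ X L Y z≤n))) (step py M ≤-refl)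

  -- The last interior vertex of Y is an apex over X followed by the rest of Y.
  twoInducedPaths⇒hole : ∀ {X Y L M} → IsInducedPath X L → IsInducedPath Y M → 2 ≤ L → 2 ≤ M →
                         X L ≡ Y 0 → Y M ≡ X 0 → InteriorsDisjoint X L Y M → InteriorsNonAdjacent X L Y M →
                         Hole G (L + M)
  twoInducedPaths⇒hole {M = zero}        _ _ _ () _ _ _ _
  twoInducedPaths⇒hole {M = suc zero}    _ _ _ (s≤s ()) _ _ _ _
  twoInducedPaths⇒hole {X} {Y} {L} {suc (suc M)} ix iy 2≤L _ XL≡Y0 Y2+M≡X0 disj nonadj =
    subst (Hole G) (sym (trans (+-suc L (suc M)) (cong suc (+-suc L M))))
      (apex⇒hole Z (≤-trans 2≤L (m≤m+n L M)) w w∉Z w~Z0 w~ZM w≁Z)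
    where
    py = isPath iy
    w = Y (suc M)
    M≤2+M : M ≤ suc (suc M)
    M≤2+M = m≤n⇒m≤1+n (n≤1+n M)
    disj′ : JoinDisjoint X L Y M
    disj′ zero    j _   0<j j≤M e = 1+n≰n (≤-trans (s≤s (m≤n⇒m≤1+n j≤M)) (≤-reflexive
      (injective py (suc (suc M)) j ≤-refl (≤-trans j≤M M≤2+M) (trans Y2+M≡X0 e))))
    disj′ (suc i) j i<L 0<j j≤M = disj (suc i) j (s≤s z≤n) i<L 0<j (s≤s (m≤n⇒m≤1+n j≤M))
    nonadj′ : JoinNonAdjacent X L Y M
    nonadj′ zero j _ 0<j j≤M a
      with chordless iy (suc (suc M)) j ≤-refl (≤-trans j≤M M≤2+M) (subst (_~ Y j) (sym Y2+M≡X0) a)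
    ... | inj₁ refl = 1+n≰n (≤-trans (s≤s M≤2+M) j≤M)
    ... | inj₂ refl = 1+n≰n j≤M
    nonadj′ (suc i) j i<L 0<j j≤M = nonadj (suc i) j (s≤s z≤n) i<L 0<j (s≤s (m≤n⇒m≤1+n j≤M))
    Z : IsInducedPath (join X L Y) (L + M)
    Z = isInducedPath-join ix (isInducedPath-prefix M≤2+M iy) XL≡Y0 disj′ nonadj′
    w∉Z : ∀ r → r ≤ L + M → join X L Y r ≢ w
    w∉Z r r≤ e with split L r
    ... | >-part b refl = 1+n≰n (≤-trans (s≤s (>-part-bound r≤)) (≤-reflexive
      (injective py (suc M) (suc b) (n≤1+n (suc M)) (m≤n⇒m≤1+n (≤-trans (>-part-bound r≤) (n≤1+n M)))
        (sym (trans (sym (join-+ X L Y XL≡Y0 (suc b))) e)))))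
    ... | ≤-part r≤L with m≤n⇒m<n∨m≡n r≤L
    ...   | inj₂ refl = 0≢1+n (injective py 0 (suc M) z≤n (n≤1+n (suc M))
      (trans (sym XL≡Y0) (trans (sym (join-≤ X L Y r≤L)) e)))
    ...   | inj₁ r<L with r
    ...     | zero  = 1+n≢n (injective py (suc (suc M)) (suc M) ≤-refl (n≤1+n (suc M))
      (trans Y2+M≡X0 (trans (sym (join-≤ X L Y r≤L)) e)))
    ...     | suc r′ = disj (suc r′) (suc M) (s≤s z≤n) r<L (s≤s z≤n) ≤-refl (trans (sym (join-≤ X L Y r≤L)) e)
    w~Z0 : w ~ join X L Y 0
    w~Z0 = subst (w ~_) (trans Y2+M≡X0 (sym (join-≤ X L Y z≤n))) (step py (suc M) ≤-refl)
    w~ZM : w ~ join X L Y (L + M)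
    w~ZM = subst (w ~_) (sym (join-+ X L Y XL≡Y0 M)) (~-sym (step py M (n≤1+n (suc M))))
    w≁Z : ∀ r → 0 < r → r < L + M → ¬ w ~ join X L Y r
    w≁Z r 0<r r< a with split L r
    ... | >-part b refl
      with chordless iy (suc M) (suc b) (n≤1+n (suc M)) (≤-trans (>-part-bound (<⇒≤ r<)) (m≤n⇒m≤1+n (n≤1+n M)))
             (subst (w ~_) (join-+ X L Y XL≡Y0 (suc b)) a)
    ...   | inj₁ refl = 1+n≰n (≤-trans (n≤1+n (suc M)) (>-part-bound (<⇒≤ r<)))
    ...   | inj₂ refl = <-irrefl refl r<
    w≁Z r 0<r r< a | ≤-part r≤L with m≤n⇒m<n∨m≡n r≤L
    ...   | inj₁ r<L = nonadj r (suc M) 0<r r<L (s≤s z≤n) ≤-refl (~-sym (subst (w ~_) (join-≤ X L Y r≤L) a))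
    ...   | inj₂ refl
      with chordless iy (suc M) 0 (n≤1+n (suc M)) z≤n (subst (w ~_) (trans (join-≤ X L Y r≤L) XL≡Y0) a)
    ...     | inj₂ refl = <-irrefl (sym (+-identityʳ r)) r<

  edge : V → V → ℕ → V
  edge u v zero    = u
  edge u v (suc _) = v

  edge-isInducedPath : ∀ {u v} → u ≢ v → u ~ v → IsInducedPath (edge u v) 1
  edge-isInducedPath {u} {v} u≢v u~v = mkInducedPath (mkPath inj′ (λ { zero _ → u~v ; (suc _) (s≤s ()) }))
    (λ { zero zero _ _ a → ⊥-elim (Graph.irrefl G a)
       ; zero (suc zero) _ _ _ → inj₁ refl
       ; (suc zero) zero _ _ _ → inj₂ refl
       ; (suc zero) (suc zero) _ _ a → ⊥-elim (Graph.irrefl G a)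
       ; (suc (suc _)) _ (s≤s ()) _ _
       ; _ (suc (suc _)) _ (s≤s ()) _ })
    where
    inj′ : InjectiveUpTo (edge u v) 1
    inj′ zero       zero       _ _ _ = refl
    inj′ zero       (suc zero) _ _ e = ⊥-elim (u≢v e)
    inj′ (suc zero) zero       _ _ e = ⊥-elim (u≢v (sym e))
    inj′ (suc zero) (suc zero) _ _ _ = refl
    inj′ (suc (suc _)) _ (s≤s ()) _ _
    inj′ _ (suc (suc _)) _ (s≤s ()) _

hole⇒cycle : ∀ {n} {G : Graph n} {m} → Hole G m → Cycle G m
hole⇒cycle H = record
  { three≤k = ≤-trans (n≤1+n 3) (four≤k H) ; vtx = vtx H ; inj = inj H
  ; edges = λ i j c → Equivalence.from (induced H i j) c }

module EvenHoles {n : ℕ} {G : Graph n} (ℓ : ℕ) (girth : ∀ m → Cycle G m → 2 * ℓ ≤ m)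
                 (noLongEvenHole : ∀ m → Hole G m → Even m → m < 2 * ℓ + 2) where

  evenHole-length : ∀ {m} → Hole G m → Even m → m ≡ ℓ + ℓ
  evenHole-length {m} H m-even = even-pinched m-even
    (subst (_≤ m) (2*n≡n+n ℓ) (girth m (hole⇒cycle H)))
    (subst (m <_) (2*ℓ+2≡1+ℓ+1+ℓ ℓ) (noLongEvenHole m H m-even))
    where
    2*ℓ+2≡1+ℓ+1+ℓ : ∀ ℓ → 2 * ℓ + 2 ≡ suc ℓ + suc ℓ
    2*ℓ+2≡1+ℓ+1+ℓ = solve-∀

module OnHole {n : ℕ} {G : Graph n} {K : ℕ} (C : Hole G (suc K)) where
  open Walks G

  at : ℕ → V
  at c = vtx C (position c)

  at-toℕ : ∀ x → at (toℕ x) ≡ vtx C x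
  at-toℕ x = cong (vtx C) (position-toℕ x)

  at-injective : ∀ {c d} → c ≤ K → d ≤ K → at c ≡ at d → c ≡ d
  at-injective c≤K d≤K e = trans (sym (toℕ-position c≤K)) (trans (cong toℕ (inj C e)) (toℕ-position d≤K))

  at-adjacent⇒neighbours : ∀ {c d} → c ≤ K → d ≤ K → at c ~ at d → Neighbours K c d
  at-adjacent⇒neighbours c≤K d≤K a = subst₂ (Neighbours K) (toℕ-position c≤K) (toℕ-position d≤K)
    (cycConsec⇒neighbours _ _ (Equivalence.to (induced C _ _) a))

  neighbours⇒at-adjacent : ∀ {c d} → c ≤ K → d ≤ K → Neighbours K c d → at c ~ at d
  neighbours⇒at-adjacent c≤K d≤K nb = Equivalence.from (induced C _ _)
    (neighbours⇒cycConsec _ _ (subst₂ (Neighbours K) (sym (toℕ-position c≤K)) (sym (toℕ-position d≤K)) nb))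

  record IsArc (π : ℕ → ℕ) (M : ℕ) : Set where
    field
      bounded       : ∀ j → j ≤ M → π j ≤ K
      distinct      : ∀ i j → i ≤ M → j ≤ M → π i ≡ π j → i ≡ j
      advances      : ∀ i → i < M → Neighbours K (π i) (π (suc i))
      arc-chordless : ∀ i j → i ≤ M → j ≤ M → Neighbours K (π i) (π j) → Consecutive i j
  open IsArc public

  isArc⇒isInducedPath : ∀ {π M} → IsArc π M → IsInducedPath (λ j → at (π j)) M
  isArc⇒isInducedPath {π} arc = mkInducedPath
    (mkPath (λ i j i≤ j≤ e → distinct arc i j i≤ j≤ (at-injective (bounded arc i i≤) (bounded arc j j≤) e))
            (λ i i< → neighbours⇒at-adjacent (bounded arc i (<⇒≤ i<)) (bounded arc (suc i) i<) (advances arc i i<)))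
    (λ i j i≤ j≤ a → arc-chordless arc i j i≤ j≤ (at-adjacent⇒neighbours (bounded arc i i≤) (bounded arc j j≤) a))

  isArc-reverse : ∀ {π M} → IsArc π M → IsArc (λ j → π (M ∸ j)) M
  isArc-reverse {π} {M} arc = record
    { bounded       = λ j _ → bounded arc (M ∸ j) (m∸n≤m M j)
    ; distinct      = λ i j i≤ j≤ e → ∸-cancelˡ-≡ i≤ j≤ (distinct arc (M ∸ i) (M ∸ j) (m∸n≤m M i) (m∸n≤m M j) e)
    ; advances      = λ i i< → neighbours-sym
        (subst (λ k → Neighbours K (π (M ∸ suc i)) (π k)) (sym (L∸i≡1+[L∸1+i] i<)) (advances arc (M ∸ suc i) (L∸1+i<L i<)))
    ; arc-chordless = λ i j i≤ j≤ nb →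
        consecutive-∸ˡ⁻ M i≤ j≤ (arc-chordless arc (M ∸ i) (M ∸ j) (m∸n≤m M i) (m∸n≤m M j) nb)
    }

  forwardArc : ∀ u M → u + M ≤ K → 0 < u ⊎ M < K → IsArc (u +_) M
  forwardArc u M u+M≤K notExtremes = record
    { bounded       = λ j j≤M → ≤-trans (+-monoʳ-≤ u j≤M) u+M≤K
    ; distinct      = λ i j _ _ → +-cancelˡ-≡ u i j
    ; advances      = λ i _ → inj₁ (inj₁ (sym (+-suc u i)))
    ; arc-chordless = chordless′
    }
    where
    not-0-and-K : ∀ i j → j ≤ M → u + i ≡ 0 → u + j ≢ K
    not-0-and-K i j j≤M u+i≡0 u+j≡K with m+n≡0⇒m≡0 u u+i≡0
    ... | refl = [ (λ ()) , (λ M<K → <⇒≱ M<K (≤-trans (≤-reflexive (sym u+j≡K)) j≤M)) ]′ notExtremes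
    chordless′ : ∀ i j → i ≤ M → j ≤ M → Neighbours K (u + i) (u + j) → Consecutive i j
    chordless′ i j _   _   (inj₁ c)                = consecutive-+ˡ⁻ u c
    chordless′ i j _   j≤M (inj₂ (inj₁ (e₀ , eK))) = ⊥-elim (not-0-and-K i j j≤M e₀ eK)
    chordless′ i j i≤M _   (inj₂ (inj₂ (e₀ , eK))) = ⊥-elim (not-0-and-K j i i≤M e₀ eK)

  -- Walking around C from position u: u, u + 1, …, K, 0, 1, …
  wrapping : ℕ → ℕ → ℕ
  wrapping u j with j ≤? K ∸ u
  ... | yes _ = u + j
  ... | no  _ = j ∸ suc (K ∸ u)

  wrapping-≤ : ∀ u {j} → j ≤ K ∸ u → wrapping u j ≡ u + j
  wrapping-≤ u {j} j≤ with j ≤? K ∸ u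
  ... | yes _ = refl
  ... | no  j≰ = ⊥-elim (j≰ j≤)

  wrapping-> : ∀ u t → wrapping u ((K ∸ u) + suc t) ≡ t
  wrapping-> u t with (K ∸ u) + suc t ≤? K ∸ u
  ... | yes j≤ = ⊥-elim (<⇒≱ (m<m+n (K ∸ u) (s≤s z≤n)) j≤)
  ... | no  _  = trans (cong (_∸ suc (K ∸ u)) (+-suc (K ∸ u) t)) (m+n∸m≡n (suc (K ∸ u)) t)

  wrapping-range : ∀ u {v j} → j ≤ (K ∸ u) + suc v → u ≤ wrapping u j ⊎ wrapping u j ≤ v
  wrapping-range u {v} {j} j≤ with split (K ∸ u) j
  ... | ≤-part j≤D    = inj₁ (subst (u ≤_) (sym (wrapping-≤ u j≤D)) (m≤m+n u j))
  ... | >-part t refl = inj₂ (subst (_≤ v) (sym (wrapping-> u t)) (≤-pred (>-part-bound j≤)))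

  module _ {u v} (2+v≤u : suc (suc v) ≤ u) (u≤K : u ≤ K) where

    private
      D = K ∸ u
      u+D≡K : u + D ≡ K
      u+D≡K = m+[n∸m]≡n u≤K
      tail : ∀ {t} → D + suc t ≤ D + suc v → t ≤ v
      tail t≤ = ≤-pred (>-part-bound t≤)
      tail+1<head : ∀ {t} i → t ≤ v → suc t < u + i
      tail+1<head i t≤v = ≤-trans (s≤s (s≤s t≤v)) (≤-trans 2+v≤u (m≤m+n u i))
      tail<head : ∀ {t} i → t ≤ v → t < u + i
      tail<head i t≤v = <-trans (n<1+n _) (tail+1<head i t≤v)
      tail<K : ∀ {t} → t ≤ v → t < K
      tail<K t≤v = ≤-trans (tail<head 0 t≤v) (≤-trans (≤-reflexive (+-identityʳ u)) u≤K)
      head≢0 : ∀ i → u + i ≢ 0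
      head≢0 i e = <⇒≢ (tail<head i z≤n) (sym e)
      bounded′ : ∀ j → j ≤ D + suc v → wrapping u j ≤ K
      bounded′ j j≤ with split D j
      ... | ≤-part j≤D    = subst (_≤ K) (sym (wrapping-≤ u j≤D)) (≤-trans (+-monoʳ-≤ u j≤D) (≤-reflexive u+D≡K))
      ... | >-part t refl = subst (_≤ K) (sym (wrapping-> u t)) (<⇒≤ (tail<K (tail j≤)))
      distinct′ : ∀ i j → i ≤ D + suc v → j ≤ D + suc v → wrapping u i ≡ wrapping u j → i ≡ j
      distinct′ i j i≤ j≤ e with split D i | split D j
      ... | ≤-part i≤D | ≤-part j≤D =
        +-cancelˡ-≡ u i j (trans (sym (wrapping-≤ u i≤D)) (trans e (wrapping-≤ u j≤D)))
      ... | >-part s refl | >-part t refl =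
        cong (λ k → D + suc k) (trans (sym (wrapping-> u s)) (trans e (wrapping-> u t)))
      ... | ≤-part i≤D | >-part t refl =
        ⊥-elim (<⇒≢ (tail<head i (tail j≤)) (sym (trans (sym (wrapping-≤ u i≤D)) (trans e (wrapping-> u t)))))
      ... | >-part s refl | ≤-part j≤D =
        ⊥-elim (<⇒≢ (tail<head j (tail i≤)) (sym (trans (sym (wrapping-≤ u j≤D)) (trans (sym e) (wrapping-> u s)))))
      advances′ : ∀ i → i < D + suc v → Neighbours K (wrapping u i) (wrapping u (suc i))
      advances′ i i< with split D i
      ... | >-part t refl = subst₂ (Neighbours K) (sym (wrapping-> u t))
              (trans (sym (wrapping-> u (suc t))) (cong (wrapping u) (+-suc D (suc t)))) (inj₁ (inj₁ refl))
      ... | ≤-part i≤D with m≤n⇒m<n∨m≡n i≤D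
      ...   | inj₁ i<D  = subst₂ (Neighbours K) (sym (wrapping-≤ u i≤D)) (sym (wrapping-≤ u i<D))
                            (inj₁ (inj₁ (sym (+-suc u i))))
      ...   | inj₂ refl = subst₂ (Neighbours K) (sym (trans (wrapping-≤ u i≤D) u+D≡K))
                            (trans (sym (wrapping-> u 0)) (cong (wrapping u) (+-comm D 1)))
                            (inj₂ (inj₂ (refl , refl)))
      head~tail⇒junction : ∀ i t → t ≤ v → Neighbours K (u + i) t → Consecutive i (D + suc t)
      head~tail⇒junction i t t≤v (inj₁ (inj₁ e))          =
        ⊥-elim (<⇒≱ (tail<head i t≤v) (≤-trans (n≤1+n _) (≤-reflexive e)))
      head~tail⇒junction i t t≤v (inj₁ (inj₂ e))          = ⊥-elim (<⇒≢ (tail+1<head i t≤v) e)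
      head~tail⇒junction i t t≤v (inj₂ (inj₁ (e , _)))    = ⊥-elim (head≢0 i e)
      head~tail⇒junction i t t≤v (inj₂ (inj₂ (refl , e))) =
        inj₁ (trans (cong suc (+-cancelˡ-≡ u i D (trans e (sym u+D≡K)))) (+-comm 1 D))
      chordless′ : ∀ i j → i ≤ D + suc v → j ≤ D + suc v →
                   Neighbours K (wrapping u i) (wrapping u j) → Consecutive i j
      chordless′ i j i≤ j≤ nb with split D i | split D j
      ... | ≤-part i≤D | ≤-part j≤D with subst₂ (Neighbours K) (wrapping-≤ u i≤D) (wrapping-≤ u j≤D) nb
      ...   | inj₁ c                = consecutive-+ˡ⁻ u c
      ...   | inj₂ (inj₁ (e , _))   = ⊥-elim (head≢0 i e)
      ...   | inj₂ (inj₂ (e , _))   = ⊥-elim (head≢0 j e)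
      chordless′ i j i≤ j≤ nb | >-part s refl | >-part t refl
        with subst₂ (Neighbours K) (wrapping-> u s) (wrapping-> u t) nb
      ...   | inj₁ c                = consecutive-+ˡ⁺ D (consecutive-+ˡ⁺ 1 c)
      ...   | inj₂ (inj₁ (_ , e))   = ⊥-elim (<⇒≢ (tail<K (tail j≤)) e)
      ...   | inj₂ (inj₂ (_ , e))   = ⊥-elim (<⇒≢ (tail<K (tail i≤)) e)
      chordless′ i j i≤ j≤ nb | ≤-part i≤D | >-part t refl =
        head~tail⇒junction i t (tail j≤) (subst₂ (Neighbours K) (wrapping-≤ u i≤D) (wrapping-> u t) nb)
      chordless′ i j i≤ j≤ nb | >-part s refl | ≤-part j≤D = consecutive-sym
        (head~tail⇒junction j s (tail i≤) (neighbours-sym (subst₂ (Neighbours K) (wrapping-> u s) (wrapping-≤ u j≤D) nb)))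

    wrappingArc : IsArc (wrapping u) ((K ∸ u) + suc v)
    wrappingArc = record
      { bounded = bounded′ ; distinct = distinct′ ; advances = advances′ ; arc-chordless = chordless′ }

  Outside : V → Set
  Outside v = ∀ c → c ≤ K → at c ≢ v

  record ShortJump (s t L : ℕ) : Set where
    field
      vertex    : ℕ → V
      isInduced : IsInducedPath vertex L
      first     : vertex 0 ≡ at s
      last      : vertex L ≡ at t
      avoids    : ∀ i → 0 < i → i < L → Outside (vertex i)
      short     : ∀ c → c ≤ K → c ≢ s → c ≢ t → ∀ i → 0 < i → i < L → ¬ at c ~ vertex i
  open ShortJump public

  shortJump-reverse : ∀ {s t L} → ShortJump s t L → ShortJump t s L
  shortJump-reverse {L = L} J = record
    { vertex    = reverse L (vertex J)
    ; isInduced = isInducedPath-reverse (isInduced J)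
    ; first     = last J
    ; last      = trans (cong (vertex J) (n∸n≡0 L)) (first J)
    ; avoids    = λ i 0<i i<L → let (0<i′ , i′<L) = interior-reverse 0<i i<L in avoids J (L ∸ i) 0<i′ i′<L
    ; short     = λ c c≤K c≢t c≢s i 0<i i<L →
        let (0<i′ , i′<L) = interior-reverse 0<i i<L in short J c c≤K c≢s c≢t (L ∸ i) 0<i′ i′<L
    }

  module _ {a b : Fin (suc K)} (P : Jump G C a b) where

    private
      L = len P
      walk : ℕ → V
      walk i = vtx (path P) (position {L} i)
      internal : ∀ {i} → 0 < i → i < L → Internal L (position {L} i)
      internal {i} 0<i i<L =
        (λ e → <⇒≢ 0<i (sym (trans (sym (toℕ-position (<⇒≤ i<L))) e))) ,
        (λ e → <⇒≢ i<L (trans (sym (toℕ-position (<⇒≤ i<L))) e))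
      position-≢ : ∀ {c x} → c ≤ K → c ≢ toℕ x → position {K} c ≢ x
      position-≢ c≤K c≢x e = c≢x (trans (sym (toℕ-position c≤K)) (cong toℕ e))

    ends-not-neighbours : ¬ Neighbours K (toℕ a) (toℕ b)
    ends-not-neighbours nb = nonadj P (subst₂ _~_ (at-toℕ a) (at-toℕ b)
      (neighbours⇒at-adjacent (Fin.toℕ≤pred[n] a) (Fin.toℕ≤pred[n] b) nb))

    fromJump : Short P → ShortJump (toℕ a) (toℕ b) L
    fromJump shortP = record
      { vertex    = walk
      ; isInduced = inducedPath⇒isInducedPath (path P)
      ; first     = trans (cong (vtx (path P)) (position-toℕ Fin.zero)) (trans (start P) (sym (at-toℕ a)))
      ; last      = trans (cong (vtx (path P)) (Fin.toℕ-injective (trans (toℕ-position ≤-refl) (sym (Fin.toℕ-fromℕ L)))))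
                          (trans (end P) (sym (at-toℕ b)))
      ; avoids    = λ i 0<i i<L c c≤K e → outside P (position i) (internal 0<i i<L) (position c) e
      ; short     = λ c c≤K c≢a c≢b i 0<i i<L →
          shortP (position c) (position-≢ c≤K c≢a) (position-≢ c≤K c≢b) (position i) (internal 0<i i<L)
      }

  shortJump-length : ∀ {s t L} → ShortJump s t L → s ≤ K → t ≤ K → s ≢ t → ¬ Neighbours K s t → 2 ≤ L
  shortJump-length {L = zero} J s≤K t≤K s≢t _ =
    ⊥-elim (s≢t (at-injective s≤K t≤K (trans (sym (first J)) (last J))))
  shortJump-length {L = suc zero} J s≤K t≤K _ ¬nb =
    ⊥-elim (¬nb (at-adjacent⇒neighbours s≤K t≤K (subst₂ _~_ (first J) (last J) (step (isPath (isInduced J)) 0 ≤-refl))))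
  shortJump-length {L = suc (suc _)} _ _ _ _ _ = s≤s (s≤s z≤n)

  jump+arc⇒hole : ∀ {s t L π M} → ShortJump s t L → 2 ≤ L →
                  IsArc π M → π 0 ≡ t → π M ≡ s → 2 ≤ M → Hole G (L + M)
  jump+arc⇒hole {π = π} {M} J 2≤L arc π0≡t πM≡s 2≤M =
    twoInducedPaths⇒hole (isInduced J) (isArc⇒isInducedPath arc) 2≤L 2≤M
      (trans (last J) (cong at (sym π0≡t))) (trans (cong at πM≡s) (sym (first J)))
      (λ i j 0<i i<L 0<j j<M e → avoids J i 0<i i<L (π j) (bounded arc j (<⇒≤ j<M)) (sym e))
      (λ i j 0<i i<L 0<j j<M a → short J (π j) (bounded arc j (<⇒≤ j<M))
         (λ e → <⇒≢ j<M (distinct arc j M (<⇒≤ j<M) ≤-refl (trans e (sym πM≡s))))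
         (λ e → <⇒≢ 0<j (sym (distinct arc j 0 (<⇒≤ j<M) z≤n (trans e (sym π0≡t)))))
         i 0<i i<L (~-sym a))

  module _ {s t L} (J : ShortJump s t L) (s<t : s < t) (t≤K : t ≤ K) (¬nb : ¬ Neighbours K s t) where

    private
      s+2≤t : suc (suc s) ≤ t
      s+2≤t = proj₁ (¬neighbours⇒gap s<t t≤K ¬nb)
      notExtremes : 0 < s ⊎ t < K
      notExtremes = proj₂ (¬neighbours⇒gap s<t t≤K ¬nb)
      2≤L : 2 ≤ L
      2≤L = shortJump-length J (≤-trans (<⇒≤ s<t) t≤K) t≤K (<⇒≢ s<t) ¬nb
      s+[t∸s]≡t : s + (t ∸ s) ≡ t
      s+[t∸s]≡t = m+[n∸m]≡n (<⇒≤ s<t)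

    hole-with-inner-arc : Hole G (L + (t ∸ s))
    hole-with-inner-arc = jump+arc⇒hole J 2≤L
      (isArc-reverse (forwardArc s (t ∸ s) (subst (_≤ K) (sym s+[t∸s]≡t) t≤K)
        ([ inj₁ , (λ t<K → inj₂ (≤-<-trans (m∸n≤m t s) t<K)) ]′ notExtremes)))
      s+[t∸s]≡t (trans (cong (s +_) (n∸n≡0 (t ∸ s))) (+-identityʳ s)) (m+n≤o⇒m≤o∸n 2 s+2≤t)

    hole-with-outer-arc : Hole G (L + ((K ∸ t) + suc s))
    hole-with-outer-arc = jump+arc⇒hole J 2≤L (wrappingArc s+2≤t t≤K)
      (trans (wrapping-≤ t z≤n) (+-identityʳ t)) (wrapping-> t s) 2≤M
      where
      2≤M : 2 ≤ (K ∸ t) + suc s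
      2≤M with notExtremes
      ... | inj₁ 0<s = +-mono-≤ (z≤n {K ∸ t}) (s≤s 0<s)
      ... | inj₂ t<K = +-mono-≤ (m<n⇒0<n∸m t<K) (s≤s (z≤n {s}))

  jump++arc : ∀ {s t L π M} → (J : ShortJump s t L) → s ≤ K → IsArc π M → π 0 ≡ t →
              (∀ q → 0 < q → q ≤ M → Separated K s (π q)) →
              IsInducedPath (join (vertex J) L (λ q → at (π q))) (L + M)
  jump++arc {s} {t} {L} {π} {M} J s≤K arc π0≡t sep =
    isInducedPath-join (isInduced J) (isArc⇒isInducedPath arc) (trans (last J) (cong at (sym π0≡t))) disjoint′ nonAdjacent′
    where
    disjoint′ : JoinDisjoint (vertex J) L (λ q → at (π q)) M
    disjoint′ zero    q _   0<q q≤M e =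
      proj₁ (sep q 0<q q≤M) (at-injective s≤K (bounded arc q q≤M) (trans (sym (first J)) e))
    disjoint′ (suc i) q i<L 0<q q≤M e = avoids J (suc i) (s≤s z≤n) i<L (π q) (bounded arc q q≤M) (sym e)
    nonAdjacent′ : JoinNonAdjacent (vertex J) L (λ q → at (π q)) M
    nonAdjacent′ zero    q _   0<q q≤M a =
      proj₂ (sep q 0<q q≤M) (at-adjacent⇒neighbours s≤K (bounded arc q q≤M) (subst (_~ at (π q)) (first J) a))
    nonAdjacent′ (suc i) q i<L 0<q q≤M a = short J (π q) (bounded arc q q≤M)
      (λ e → proj₁ (sep q 0<q q≤M) (sym e))
      (λ e → <⇒≢ 0<q (sym (distinct arc q 0 q≤M z≤n (trans e (sym π0≡t)))))
      (suc i) (s≤s z≤n) i<L (~-sym a)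

  module _ {s₁ t₁ L₁ s₂ t₂ L₂ π₁ M₁ π₂ M₂}
           (J₁ : ShortJump s₁ t₁ L₁) (J₂ : ShortJump s₂ t₂ L₂) (2≤L₁ : 2 ≤ L₁) (2≤L₂ : 2 ≤ L₂)
           (arc₁ : IsArc π₁ M₁) (π₁0≡t₁ : π₁ 0 ≡ t₁) (π₁M₁≡s₂ : π₁ M₁ ≡ s₂)
           (arc₂ : IsArc π₂ M₂) (π₂0≡t₂ : π₂ 0 ≡ t₂) (π₂M₂≡s₁ : π₂ M₂ ≡ s₁)
           (arcs-separated : ∀ i j → i ≤ M₁ → j ≤ M₂ → Separated K (π₁ i) (π₂ j))
           (disjoint : InteriorsDisjoint (vertex J₁) L₁ (vertex J₂) L₂)
           (nonAdjacent : InteriorsNonAdjacent (vertex J₁) L₁ (vertex J₂) L₂)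
           where

    private
      X Y : ℕ → V
      X = join (vertex J₁) L₁ (λ q → at (π₁ q))
      Y = join (vertex J₂) L₂ (λ q → at (π₂ q))

      junction₁ : vertex J₁ L₁ ≡ at (π₁ 0)
      junction₁ = trans (last J₁) (cong at (sym π₁0≡t₁))
      junction₂ : vertex J₂ L₂ ≡ at (π₂ 0)
      junction₂ = trans (last J₂) (cong at (sym π₂0≡t₂))

      X-induced : IsInducedPath X (L₁ + M₁)
      X-induced = jump++arc J₁ (subst (_≤ K) π₂M₂≡s₁ (bounded arc₂ M₂ ≤-refl)) arc₁ π₁0≡t₁
        (λ q _ q≤M₁ → separated-sym (subst (Separated K (π₁ q)) π₂M₂≡s₁ (arcs-separated q M₂ q≤M₁ ≤-refl)))
      Y-induced : IsInducedPath Y (L₂ + M₂)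
      Y-induced = jump++arc J₂ (subst (_≤ K) π₁M₁≡s₂ (bounded arc₁ M₁ ≤-refl)) arc₂ π₂0≡t₂
        (λ q _ q≤M₂ → subst (λ c → Separated K c (π₂ q)) π₁M₁≡s₂ (arcs-separated M₁ q ≤-refl q≤M₂))

      X-interior : ∀ {r} → r < L₁ + M₁ → (r < L₁ × X r ≡ vertex J₁ r) ⊎ (Σ ℕ λ q → q < M₁ × X r ≡ at (π₁ q))
      X-interior = join-interior (vertex J₁) L₁ _ junction₁
      Y-interior : ∀ {r} → r < L₂ + M₂ → (r < L₂ × Y r ≡ vertex J₂ r) ⊎ (Σ ℕ λ q → q < M₂ × Y r ≡ at (π₂ q))
      Y-interior = join-interior (vertex J₂) L₂ _ junction₂

      π₁≤K : ∀ {q} → q < M₁ → π₁ q ≤ K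
      π₁≤K q<M₁ = bounded arc₁ _ (<⇒≤ q<M₁)
      π₂≤K : ∀ {q} → q < M₂ → π₂ q ≤ K
      π₂≤K q<M₂ = bounded arc₂ _ (<⇒≤ q<M₂)
      π₁≢s₂ : ∀ {q} → q < M₁ → π₁ q ≢ s₂
      π₁≢s₂ q<M₁ e = <⇒≢ q<M₁ (distinct arc₁ _ M₁ (<⇒≤ q<M₁) ≤-refl (trans e (sym π₁M₁≡s₂)))
      π₂≢s₁ : ∀ {q} → q < M₂ → π₂ q ≢ s₁
      π₂≢s₁ q<M₂ e = <⇒≢ q<M₂ (distinct arc₂ _ M₂ (<⇒≤ q<M₂) ≤-refl (trans e (sym π₂M₂≡s₁)))
      π₁≢t₂ : ∀ {q} → q < M₁ → π₁ q ≢ t₂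
      π₁≢t₂ q<M₁ e = proj₁ (arcs-separated _ 0 (<⇒≤ q<M₁) z≤n) (trans e (sym π₂0≡t₂))
      π₂≢t₁ : ∀ {q} → q < M₂ → π₂ q ≢ t₁
      π₂≢t₁ q<M₂ e = proj₁ (arcs-separated 0 _ z≤n (<⇒≤ q<M₂)) (trans π₁0≡t₁ (sym e))

      X-end≡Y-start : X (L₁ + M₁) ≡ Y 0
      X-end≡Y-start = trans (join-+ (vertex J₁) L₁ _ junction₁ M₁)
        (trans (cong at π₁M₁≡s₂) (sym (trans (join-≤ (vertex J₂) L₂ (λ q → at (π₂ q)) z≤n) (first J₂))))
      Y-end≡X-start : Y (L₂ + M₂) ≡ X 0
      Y-end≡X-start = trans (join-+ (vertex J₂) L₂ _ junction₂ M₂)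
        (trans (cong at π₂M₂≡s₁) (sym (trans (join-≤ (vertex J₁) L₁ (λ q → at (π₁ q)) z≤n) (first J₁))))

      X∩Y : InteriorsDisjoint X (L₁ + M₁) Y (L₂ + M₂)
      X∩Y r r′ 0<r r< 0<r′ r′< e with X-interior r< | Y-interior r′<
      ... | inj₁ (r<L₁ , ex) | inj₁ (r′<L₂ , ey) = disjoint r r′ 0<r r<L₁ 0<r′ r′<L₂ (trans (sym ex) (trans e ey))
      ... | inj₁ (r<L₁ , ex) | inj₂ (q , q<M₂ , ey) =
        avoids J₁ r 0<r r<L₁ (π₂ q) (π₂≤K q<M₂) (trans (sym ey) (trans (sym e) ex))
      ... | inj₂ (q , q<M₁ , ex) | inj₁ (r′<L₂ , ey) =
        avoids J₂ r′ 0<r′ r′<L₂ (π₁ q) (π₁≤K q<M₁) (trans (sym ex) (trans e ey))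
      ... | inj₂ (q , q<M₁ , ex) | inj₂ (q′ , q′<M₂ , ey) =
        proj₁ (arcs-separated q q′ (<⇒≤ q<M₁) (<⇒≤ q′<M₂))
          (at-injective (π₁≤K q<M₁) (π₂≤K q′<M₂) (trans (sym ex) (trans e ey)))

      X≁Y : InteriorsNonAdjacent X (L₁ + M₁) Y (L₂ + M₂)
      X≁Y r r′ 0<r r< 0<r′ r′< a with X-interior r< | Y-interior r′<
      ... | inj₁ (r<L₁ , ex) | inj₁ (r′<L₂ , ey) = nonAdjacent r r′ 0<r r<L₁ 0<r′ r′<L₂ (subst₂ _~_ ex ey a)
      ... | inj₁ (r<L₁ , ex) | inj₂ (q , q<M₂ , ey) =
        short J₁ (π₂ q) (π₂≤K q<M₂) (π₂≢s₁ q<M₂) (π₂≢t₁ q<M₂) r 0<r r<L₁ (~-sym (subst₂ _~_ ex ey a))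
      ... | inj₂ (q , q<M₁ , ex) | inj₁ (r′<L₂ , ey) =
        short J₂ (π₁ q) (π₁≤K q<M₁) (π₁≢s₂ q<M₁) (π₁≢t₂ q<M₁) r′ 0<r′ r′<L₂ (subst₂ _~_ ex ey a)
      ... | inj₂ (q , q<M₁ , ex) | inj₂ (q′ , q′<M₂ , ey) =
        proj₂ (arcs-separated q q′ (<⇒≤ q<M₁) (<⇒≤ q′<M₂))
          (at-adjacent⇒neighbours (π₁≤K q<M₁) (π₂≤K q′<M₂) (subst₂ _~_ ex ey a))

    twoJumps⇒hole : Hole G ((L₁ + M₁) + (L₂ + M₂))
    twoJumps⇒hole = twoInducedPaths⇒hole X-induced Y-induced
      (≤-trans 2≤L₁ (m≤m+n L₁ M₁)) (≤-trans 2≤L₂ (m≤m+n L₂ M₂))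
      X-end≡Y-start Y-end≡X-start X∩Y X≁Y

module Crossing {n : ℕ} {G : Graph n} (ℓ : ℕ) (girth : ∀ m → Cycle G m → 2 * ℓ ≤ m)
                {K : ℕ} (C : Hole G (suc K)) where
  open Walks G
  open OnHole C

  module _ {u v u′ v′ y ρ₁ ρ₂} (J : ShortJump u v ℓ) (J′ : ShortJump u′ v′ ℓ) (0<y : 0 < y) (y<ℓ : y < ℓ)
           (arc₁ : IsArc ρ₁ y) (ρ₁0≡u : ρ₁ 0 ≡ u) (ρ₁y≡u′ : ρ₁ y ≡ u′)
           (arc₂ : IsArc ρ₂ (ℓ ∸ y)) (ρ₂0≡u : ρ₂ 0 ≡ u) (ρ₂end≡v′ : ρ₂ (ℓ ∸ y) ≡ v′) where

    private
      f f′ R₁ R₂ : ℕ → V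
      f  = vertex J
      f′ = vertex J′
      R₁ q = at (ρ₁ q)
      R₂ q = at (ρ₂ q)

      OnJ′orC : V → Set
      OnJ′orC w = (Σ ℕ λ p → p ≤ ℓ × w ≡ f′ p) ⊎ (Σ ℕ λ c → c ≤ K × w ≡ at c)

      f′-path : IsPath f′ ℓ
      f′-path = isPath (isInduced J′)
      f′-interior-avoids : ∀ {p} → 0 < p → p < ℓ → ∀ {c} → c ≤ K → f′ p ≢ at c
      f′-interior-avoids 0<p p<ℓ c≤K e = avoids J′ _ 0<p p<ℓ _ c≤K (sym e)

      record Return (j k : ℕ) : Set where
        field
          route      : ℕ → V
          route-path : IsPath route k
          2≤k        : 2 ≤ k
          departs    : route 0 ≡ f′ j
          arrives    : route k ≡ at u
          on-J′orC   : ∀ q → 0 < q → q < k → OnJ′orC (route q)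
      open Return

      return-via-u′ : ∀ {j} → 0 < j → j < ℓ → Return j (j + y)
      return-via-u′ {j} 0<j j<ℓ = record
        { route      = T
        ; route-path = isPath-join (isPath-reverse (isPath-prefix (<⇒≤ j<ℓ) f′-path))
            (isPath-reverse (isPath (isArc⇒isInducedPath arc₁))) junction
            (λ i q i<j _ _ → f′-interior-avoids (m<n⇒0<n∸m i<j) (≤-<-trans (m∸n≤m j i) j<ℓ) (bounded arc₁ _ (m∸n≤m y q)))
        ; 2≤k        = +-mono-≤ 0<j 0<y
        ; departs    = join-≤ (reverse j f′) j (reverse y R₁) z≤n
        ; arrives    = trans (join-+ (reverse j f′) j (reverse y R₁) junction y)
                             (trans (cong R₁ (n∸n≡0 y)) (cong at ρ₁0≡u))
        ; on-J′orC   = on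
        }
        where
        T : ℕ → V
        T = join (reverse j f′) j (reverse y R₁)
        junction : reverse j f′ j ≡ reverse y R₁ 0
        junction = trans (cong f′ (n∸n≡0 j)) (trans (first J′) (cong at (sym ρ₁y≡u′)))
        on : ∀ q → 0 < q → q < j + y → OnJ′orC (T q)
        on q _ q< with join-interior (reverse j f′) j (reverse y R₁) junction q<
        ... | inj₁ (_ , e)      = inj₁ (j ∸ q , ≤-trans (m∸n≤m j q) (<⇒≤ j<ℓ) , e)
        ... | inj₂ (q′ , _ , e) = inj₂ (ρ₁ (y ∸ q′) , bounded arc₁ _ (m∸n≤m y q′) , e)

      return-via-v′ : ∀ {j} → 0 < j → j < ℓ → Return j ((ℓ ∸ j) + (ℓ ∸ y))
      return-via-v′ {j} 0<j j<ℓ = record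
        { route      = T
        ; route-path = isPath-join (isPath-shift j (ℓ ∸ j) (≤-reflexive j+[ℓ∸j]≡ℓ) f′-path)
            (isPath-reverse (isPath (isArc⇒isInducedPath arc₂))) junction
            (λ i q i< _ _ → f′-interior-avoids (≤-trans 0<j (m≤m+n j i)) (subst (j + i <_) j+[ℓ∸j]≡ℓ (+-monoʳ-< j i<))
                              (bounded arc₂ _ (m∸n≤m (ℓ ∸ y) q)))
        ; 2≤k        = +-mono-≤ (m<n⇒0<n∸m j<ℓ) (m<n⇒0<n∸m y<ℓ)
        ; departs    = trans (join-≤ (shift j f′) (ℓ ∸ j) (reverse (ℓ ∸ y) R₂) z≤n) (cong f′ (+-identityʳ j))
        ; arrives    = trans (join-+ (shift j f′) (ℓ ∸ j) (reverse (ℓ ∸ y) R₂) junction (ℓ ∸ y))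
                             (trans (cong R₂ (n∸n≡0 (ℓ ∸ y))) (cong at ρ₂0≡u))
        ; on-J′orC   = on
        }
        where
        j+[ℓ∸j]≡ℓ : j + (ℓ ∸ j) ≡ ℓ
        j+[ℓ∸j]≡ℓ = m+[n∸m]≡n (<⇒≤ j<ℓ)
        T : ℕ → V
        T = join (shift j f′) (ℓ ∸ j) (reverse (ℓ ∸ y) R₂)
        junction : shift j f′ (ℓ ∸ j) ≡ reverse (ℓ ∸ y) R₂ 0
        junction = trans (cong f′ j+[ℓ∸j]≡ℓ) (trans (last J′) (cong at (sym ρ₂end≡v′)))
        on : ∀ q → 0 < q → q < (ℓ ∸ j) + (ℓ ∸ y) → OnJ′orC (T q)
        on q _ q< with join-interior (shift j f′) (ℓ ∸ j) (reverse (ℓ ∸ y) R₂) junction q<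
        ... | inj₁ (q<ℓ∸j , e)  = inj₁ (j + q , subst (j + q ≤_) j+[ℓ∸j]≡ℓ (+-monoʳ-≤ j (<⇒≤ q<ℓ∸j)) , e)
        ... | inj₂ (q′ , _ , e) = inj₂ (ρ₂ ((ℓ ∸ y) ∸ q′) , bounded arc₂ _ (m∸n≤m (ℓ ∸ y) q′) , e)

      closes-cycle : ∀ {m Z j k} → IsPath Z m → 1 ≤ m → Z 0 ≡ at u → Z m ≡ f′ j → Return j k →
                     (∀ r → 0 < r → r < m → Outside (Z r)) →
                     (∀ r → 0 < r → r < m → ∀ p → 0 < p → p < ℓ → Z r ≢ f′ p) → ℓ + ℓ ≤ m + k
      closes-cycle {m} {Z} {k = k} Zp 1≤m Z0≡u Zm≡f′j T Z-avoids Z-misses =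
        subst (_≤ m + k) (2*n≡n+n ℓ) (girth (m + k)
          (twoPaths⇒cycle Zp (route-path T) 1≤m (≤-trans (n≤1+n 1) (2≤k T)) (+-mono-≤ 1≤m (2≤k T))
            (trans Zm≡f′j (sym (departs T))) (trans (arrives T) (sym Z0≡u)) disjoint))
        where
        disjoint : InteriorsDisjoint Z m (route T) k
        disjoint r q 0<r r<m 0<q q<k e with on-J′orC T q 0<q q<k
        ... | inj₂ (c , c≤K , Tq≡c) = Z-avoids r 0<r r<m c c≤K (sym (trans e Tq≡c))
        ... | inj₁ (zero , _ , Tq≡f′0) = Z-avoids r 0<r r<m (ρ₁ y) (bounded arc₁ y ≤-refl)
          (sym (trans e (trans Tq≡f′0 (trans (first J′) (cong at (sym ρ₁y≡u′))))))
        ... | inj₁ (suc p , p<ℓ , Tq≡f′p) with m≤n⇒m<n∨m≡n p<ℓ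
        ...   | inj₁ 1+p<ℓ = Z-misses r 0<r r<m (suc p) (s≤s z≤n) 1+p<ℓ (trans e Tq≡f′p)
        ...   | inj₂ refl = Z-avoids r 0<r r<m (ρ₂ (ℓ ∸ y)) (bounded arc₂ _ ≤-refl)
          (sym (trans e (trans Tq≡f′p (trans (last J′) (cong at (sym ρ₂end≡v′))))))

    -- Z closes one cycle through u′ and one through v′; the two girth bounds add up to 2m ≥ 2ℓ.
    path-to-J′⇒ℓ≤m : ∀ {m Z} → IsPath Z m → 1 ≤ m → Z 0 ≡ at u → ∀ {j} → 0 < j → j < ℓ → Z m ≡ f′ j →
                   (∀ r → 0 < r → r < m → Outside (Z r)) →
                   (∀ r → 0 < r → r < m → ∀ p → 0 < p → p < ℓ → Z r ≢ f′ p) → ℓ ≤ m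
    path-to-J′⇒ℓ≤m Zp 1≤m Z0≡u 0<j j<ℓ Zm≡f′j Z-avoids Z-misses = complementary-bounds⇒≤ (<⇒≤ j<ℓ) (<⇒≤ y<ℓ)
      (closes-cycle Zp 1≤m Z0≡u Zm≡f′j (return-via-u′ 0<j j<ℓ) Z-avoids Z-misses)
      (closes-cycle Zp 1≤m Z0≡u Zm≡f′j (return-via-v′ 0<j j<ℓ) Z-avoids Z-misses)

    -- At a first meeting point f i = f′ j, the prefix of J up to i is a path as in path-to-J′⇒ℓ≤m, so ℓ ≤ i.
    interiors-disjoint : InteriorsDisjoint f ℓ f′ ℓ
    interiors-disjoint = <-rec Disjoint-from noEarlierMeeting
      where
      Disjoint-from : ℕ → Set
      Disjoint-from i = ∀ j → 0 < i → i < ℓ → 0 < j → j < ℓ → f i ≢ f′ j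
      noEarlierMeeting : ∀ i → (∀ {i′} → i′ < i → Disjoint-from i′) → Disjoint-from i
      noEarlierMeeting i earlier j 0<i i<ℓ 0<j j<ℓ e = <⇒≱ i<ℓ
        (path-to-J′⇒ℓ≤m (isPath-prefix (<⇒≤ i<ℓ) (isPath (isInduced J))) 0<i (first J) 0<j j<ℓ e
          (λ r 0<r r<i → avoids J r 0<r (<-trans r<i i<ℓ))
          (λ r 0<r r<i p 0<p p<ℓ → earlier r<i p 0<r (<-trans r<i i<ℓ) 0<p p<ℓ))

    adjacent-interiors⇒ℓ≤1+i : ∀ {i j} → 0 < i → i < ℓ → 0 < j → j < ℓ → f i ~ f′ j → ℓ ≤ suc i
    adjacent-interiors⇒ℓ≤1+i {i} {j} 0<i i<ℓ 0<j j<ℓ fi~f′j = subst (ℓ ≤_) (+-comm i 1)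
      (path-to-J′⇒ℓ≤m Z-path (m≤n+m 1 i) (trans (join-≤ f i E z≤n) (first J)) 0<j j<ℓ (join-+ f i E refl 1)
         Z-avoids Z-misses)
      where
      E = edge (f i) (f′ j)
      Z = join f i E
      fi≢f′j : f i ≢ f′ j
      fi≢f′j = interiors-disjoint i j 0<i i<ℓ 0<j j<ℓ
      Z-path : IsPath Z (i + 1)
      Z-path = isPath-join (isPath-prefix (<⇒≤ i<ℓ) (isPath (isInduced J)))
        (isPath (edge-isInducedPath fi≢f′j fi~f′j)) refl
        λ { zero    (suc _) _   _ _ e → avoids J′ j 0<j j<ℓ u (subst (_≤ K) ρ₁0≡u (bounded arc₁ 0 z≤n))
                                          (trans (sym (first J)) e)
          ; (suc r) (suc _) r<i _ _   → interiors-disjoint (suc r) j (s≤s z≤n) (<-trans r<i i<ℓ) 0<j j<ℓ }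
      r≤i : ∀ {r} → r < i + 1 → r ≤ i
      r≤i {r} r< = ≤-pred (subst (suc r ≤_) (+-comm i 1) r<)
      Z-avoids : ∀ r → 0 < r → r < i + 1 → Outside (Z r)
      Z-avoids r 0<r r< = subst Outside (sym (join-≤ f i E (r≤i r<))) (avoids J r 0<r (≤-<-trans (r≤i r<) i<ℓ))
      Z-misses : ∀ r → 0 < r → r < i + 1 → ∀ p → 0 < p → p < ℓ → Z r ≢ f′ p
      Z-misses r 0<r r< p 0<p p<ℓ e =
        interiors-disjoint r p 0<r (≤-<-trans (r≤i r<) i<ℓ) 0<p p<ℓ (trans (sym (join-≤ f i E (r≤i r<))) e)

SamePair : {A : Set} → A → A → A → A → Set
SamePair u v u′ v′ = (u ≡ u′ × v ≡ v′) ⊎ (u ≡ v′ × v ≡ u′)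

samePair-swapʳ : ∀ {A : Set} {x y u v : A} → SamePair x y u v → SamePair x y v u
samePair-swapʳ (inj₁ (p , q)) = inj₂ (p , q)
samePair-swapʳ (inj₂ (p , q)) = inj₁ (p , q)

samePair-via : ∀ {A : Set} {x y u v u′ v′ : A} → SamePair x y u v → SamePair x y u′ v′ → SamePair u v u′ v′
samePair-via (inj₁ (refl , refl)) q = q
samePair-via (inj₂ (refl , refl)) q = samePair-swap q
  where
  samePair-swap : ∀ {A : Set} {x y u v : A} → SamePair x y u v → SamePair y x u v
  samePair-swap (inj₁ (p , q)) = inj₂ (q , p)
  samePair-swap (inj₂ (p , q)) = inj₁ (q , p)

module ShortTypeEJumps {n : ℕ} {G : Graph n} (ℓ : ℕ) (3≤ℓ : 3 ≤ ℓ) (girth : ∀ m → Cycle G m → 2 * ℓ ≤ m)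
                       (noLongEvenHole : ∀ m → Hole G m → Even m → m < 2 * ℓ + 2)
                       {K : ℕ} (C : Hole G (suc K)) (C-length : suc K ≡ ℓ + ℓ) where
  open Walks G
  open OnHole C
  open EvenHoles ℓ girth noLongEvenHole
  open Crossing ℓ girth C
  open ≡-Reasoning

  typeE⇒antipodal : ∀ {s t L} → ShortJump s t L → s < t → t ≤ K → ¬ Neighbours K s t → Even (L + (t ∸ s)) →
                    L ≡ ℓ × t ≡ s + ℓ
  typeE⇒antipodal {s} {t} {L} J s<t t≤K ¬nb L+d-even = L≡ℓ , trans (sym (m+[n∸m]≡n (<⇒≤ s<t))) (cong (s +_) d≡ℓ)
    where
    d = t ∸ s
    M = (K ∸ t) + suc s
    M+d≡2ℓ : M + d ≡ ℓ + ℓ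
    M+d≡2ℓ = begin
      (K ∸ t) + suc s + d     ≡⟨ regroup (K ∸ t) s d ⟩
      suc (s + d + (K ∸ t))   ≡⟨ cong (λ k → suc (k + (K ∸ t))) (m+[n∸m]≡n (<⇒≤ s<t)) ⟩
      suc (t + (K ∸ t))       ≡⟨ cong suc (m+[n∸m]≡n t≤K) ⟩
      suc K                   ≡⟨ C-length ⟩
      ℓ + ℓ                   ∎
      where
      regroup : ∀ e s d → e + suc s + d ≡ suc (s + d + e)
      regroup = solve-∀
    L+d≡2ℓ : L + d ≡ ℓ + ℓ
    L+d≡2ℓ = evenHole-length (hole-with-inner-arc J s<t t≤K ¬nb) L+d-even
    L+M-even : Even (L + M)
    L+M-even = even-cancel-double (L + M) d {ℓ + ℓ} (begin
      (L + M) + (d + d)   ≡⟨ swap L M d ⟩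
      (L + d) + (M + d)   ≡⟨ cong₂ _+_ L+d≡2ℓ M+d≡2ℓ ⟩
      (ℓ + ℓ) + (ℓ + ℓ)   ∎)
      where
      swap : ∀ L M d → (L + M) + (d + d) ≡ (L + d) + (M + d)
      swap = solve-∀
    d≡M : d ≡ M
    d≡M = +-cancelˡ-≡ L d M (trans L+d≡2ℓ (sym (evenHole-length (hole-with-outer-arc J s<t t≤K ¬nb) L+M-even)))
    d≡ℓ : d ≡ ℓ
    d≡ℓ = n+n-injective (trans (cong (d +_) d≡M) (trans (+-comm d M) M+d≡2ℓ))
    L≡ℓ : L ≡ ℓ
    L≡ℓ = +-cancelʳ-≡ ℓ L ℓ (trans (cong (L +_) (sym d≡ℓ)) L+d≡2ℓ)

  doubled-hole-impossible : ∀ z → 0 < z → ¬ Hole G ((ℓ + z) + (ℓ + z))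
  doubled-hole-impossible z 0<z H = <⇒≢ (m<m+n ℓ 0<z) (sym (n+n-injective (evenHole-length H (ℓ + z , refl))))

  module _ {a x} (0<x : 0 < x) (b′≤K : a + ℓ + x ≤ K)
           (J₁ : ShortJump a (a + ℓ) ℓ) (J₂ : ShortJump (a + x) (a + ℓ + x) ℓ) where

    private
      b a′ b′ M : ℕ
      b  = a + ℓ
      a′ = a + x
      b′ = b + x
      M  = (K ∸ b′) + suc a

      2≤ℓ : 2 ≤ ℓ
      2≤ℓ = ≤-trans (n≤1+n 2) 3≤ℓ
      x<ℓ : x < ℓ
      x<ℓ = +-cancelˡ-< ℓ x ℓ (≤-trans (s≤s (≤-trans (+-monoˡ-≤ x (m≤n+m ℓ a)) b′≤K)) (≤-reflexive C-length))
      b≤K : b ≤ K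
      b≤K = ≤-trans (m≤m+n b x) b′≤K
      a′<b : a′ < b
      a′<b = +-monoʳ-< a x<ℓ
      0<a′ : 0 < a′
      0<a′ = ≤-trans 0<x (m≤n+m x a)
      0<b : 0 < b
      0<b = ≤-trans (≤-trans (s≤s z≤n) 3≤ℓ) (m≤n+m ℓ a)
      a′+[ℓ∸x]≡b : a′ + (ℓ ∸ x) ≡ b
      a′+[ℓ∸x]≡b = trans (+-assoc a x (ℓ ∸ x)) (cong (a +_) (m+[n∸m]≡n (<⇒≤ x<ℓ)))
      M≡ℓ∸x : M ≡ ℓ ∸ x
      M≡ℓ∸x = trans (sym (m+n∸n≡m M x)) (cong (_∸ x) (+-cancelʳ-≡ ℓ (M + x) ℓ (begin
        (K ∸ b′) + suc a + x + ℓ     ≡⟨ regroup (K ∸ b′) a x ℓ ⟩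
        suc (a + ℓ + x + (K ∸ b′))   ≡⟨ cong suc (m+[n∸m]≡n b′≤K) ⟩
        suc K                        ≡⟨ C-length ⟩
        ℓ + ℓ                        ∎)))
        where
        regroup : ∀ e a x ℓ → e + suc a + x + ℓ ≡ suc (a + ℓ + x + e)
        regroup = solve-∀

      a→a′ : IsArc (a +_) x
      a→a′ = forwardArc a x (≤-trans (<⇒≤ a′<b) b≤K) (inj₂ (<-≤-trans x<ℓ (≤-trans (m≤n+m ℓ a) b≤K)))
      b→b′ : IsArc (b +_) x
      b→b′ = forwardArc b x b′≤K (inj₁ 0<b)
      b′→a : IsArc (wrapping b′) M
      b′→a = wrappingArc (subst (_≤ b′) (+-comm a 2) (≤-trans (+-monoʳ-≤ a 2≤ℓ) (m≤m+n b x))) b′≤K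
      a→b′ : IsArc (λ j → wrapping b′ (M ∸ j)) (ℓ ∸ x)
      a→b′ = subst (IsArc _) M≡ℓ∸x (isArc-reverse b′→a)
      a→b′-end : wrapping b′ (M ∸ (ℓ ∸ x)) ≡ b′
      a→b′-end = trans (cong (λ z → wrapping b′ (M ∸ z)) (sym M≡ℓ∸x))
                       (trans (cong (wrapping b′) (n∸n≡0 M)) (trans (wrapping-≤ b′ z≤n) (+-identityʳ b′)))
      b→a′ : IsArc (λ j → a′ + ((ℓ ∸ x) ∸ j)) (ℓ ∸ x)
      b→a′ = isArc-reverse (forwardArc a′ (ℓ ∸ x) (subst (_≤ K) (sym a′+[ℓ∸x]≡b) b≤K) (inj₁ 0<a′))
      b→a′-end : a′ + ((ℓ ∸ x) ∸ (ℓ ∸ x)) ≡ a′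
      b→a′-end = trans (cong (a′ +_) (n∸n≡0 (ℓ ∸ x))) (+-identityʳ a′)


      disjoint : InteriorsDisjoint (vertex J₁) ℓ (vertex J₂) ℓ
      disjoint = interiors-disjoint J₁ J₂ 0<x x<ℓ a→a′ (+-identityʳ a) refl a→b′ (wrapping-> b′ a) a→b′-end

      -- An edge between interior vertices i of J₁ and j of J₂ gives ℓ ≤ i + 1 and, reading both jumps
      -- backwards, ℓ ≤ (ℓ − i) + 1.
      nonAdjacent : InteriorsNonAdjacent (vertex J₁) ℓ (vertex J₂) ℓ
      nonAdjacent i j 0<i i<ℓ 0<j j<ℓ fi~f′j = <⇒≱ 3≤ℓ (≤-trans from-b (s≤s ℓ∸i≤1))
        where
        from-a : ℓ ≤ suc i
        from-a = adjacent-interiors⇒ℓ≤1+i J₁ J₂ 0<x x<ℓ a→a′ (+-identityʳ a) refl a→b′ (wrapping-> b′ a) a→b′-end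
                   0<i i<ℓ 0<j j<ℓ fi~f′j
        ℓ∸i≤1 : ℓ ∸ i ≤ 1
        ℓ∸i≤1 = subst (ℓ ∸ i ≤_) (m+n∸n≡m 1 i) (∸-monoˡ-≤ i from-a)
        from-b : ℓ ≤ suc (ℓ ∸ i)
        from-b = adjacent-interiors⇒ℓ≤1+i (shortJump-reverse J₁) (shortJump-reverse J₂) 0<x x<ℓ
                   b→b′ (+-identityʳ b) refl b→a′ a′+[ℓ∸x]≡b b→a′-end
                   (proj₁ (interior-reverse 0<i i<ℓ)) (proj₂ (interior-reverse 0<i i<ℓ))
                   (proj₁ (interior-reverse 0<j j<ℓ)) (proj₂ (interior-reverse 0<j j<ℓ))
                   (subst₂ _~_ (cong (vertex J₁) (sym (m∸[m∸n]≡n (<⇒≤ i<ℓ))))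
                               (cong (vertex J₂) (sym (m∸[m∸n]≡n (<⇒≤ j<ℓ)))) fi~f′j)

      disjoint-reversed : InteriorsDisjoint (vertex J₁) ℓ (reverse ℓ (vertex J₂)) ℓ
      disjoint-reversed i j 0<i i<ℓ 0<j j<ℓ =
        disjoint i (ℓ ∸ j) 0<i i<ℓ (proj₁ (interior-reverse 0<j j<ℓ)) (proj₂ (interior-reverse 0<j j<ℓ))
      nonAdjacent-reversed : InteriorsNonAdjacent (vertex J₁) ℓ (reverse ℓ (vertex J₂)) ℓ
      nonAdjacent-reversed i j 0<i i<ℓ 0<j j<ℓ =
        nonAdjacent i (ℓ ∸ j) 0<i i<ℓ (proj₁ (interior-reverse 0<j j<ℓ)) (proj₂ (interior-reverse 0<j j<ℓ))

    hole-via-short-arcs : x + 2 ≤ ℓ → Hole G ((ℓ + x) + (ℓ + x))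
    hole-via-short-arcs x+2≤ℓ = twoJumps⇒hole J₁ (shortJump-reverse J₂) 2≤ℓ 2≤ℓ
      b→b′ (+-identityʳ b) refl (isArc-reverse a→a′) refl (trans (cong (a +_) (n∸n≡0 x)) (+-identityʳ a))
      separated disjoint-reversed nonAdjacent-reversed
      where
      m+[n+2] : ∀ m n → m + (n + 2) ≡ suc (suc (m + n))
      m+[n+2] = solve-∀
      a′+2≤b : suc (suc a′) ≤ b
      a′+2≤b = subst (_≤ b) (m+[n+2] a x) (+-monoʳ-≤ a x+2≤ℓ)
      b′<K : a ≡ 0 → b′ < K
      b′<K refl = ≤-pred (subst₂ _≤_ (m+[n+2] ℓ x) (sym C-length) (+-monoʳ-≤ ℓ x+2≤ℓ))
      separated : ∀ i j → i ≤ x → j ≤ x → Separated K (b + i) (a + (x ∸ j))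
      separated i j i≤x j≤x = separated-sym (gap⇒separated
        (≤-trans (s≤s (s≤s (+-monoʳ-≤ a (m∸n≤m x j)))) (≤-trans a′+2≤b (m≤m+n b i)))
        (notExtremes (<-≤-connex 0 a)))
        where
        notExtremes : 0 < a ⊎ a ≤ 0 → 0 < a + (x ∸ j) ⊎ b + i < K
        notExtremes (inj₁ 0<a) = inj₁ (≤-trans 0<a (m≤m+n a _))
        notExtremes (inj₂ a≤0) = inj₂ (≤-<-trans (+-monoʳ-≤ b i≤x) (b′<K (n≤0⇒n≡0 a≤0)))

    hole-via-long-arcs : 2 ≤ x → Hole G ((ℓ + (ℓ ∸ x)) + (ℓ + (ℓ ∸ x)))
    hole-via-long-arcs 2≤x = subst (λ m → Hole G ((ℓ + (ℓ ∸ x)) + (ℓ + m))) M≡ℓ∸x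
      (twoJumps⇒hole J₁ J₂ 2≤ℓ 2≤ℓ b→a′ a′+[ℓ∸x]≡b b→a′-end
        b′→a (trans (wrapping-≤ b′ z≤n) (+-identityʳ b′)) (wrapping-> b′ a) separated disjoint nonAdjacent)
      where
      c≤b : ∀ i → a′ + ((ℓ ∸ x) ∸ i) ≤ b
      c≤b i = subst (a′ + ((ℓ ∸ x) ∸ i) ≤_) a′+[ℓ∸x]≡b (+-monoʳ-≤ a′ (m∸n≤m (ℓ ∸ x) i))
      separated : ∀ i j → i ≤ ℓ ∸ x → j ≤ M → Separated K (a′ + ((ℓ ∸ x) ∸ i)) (wrapping b′ j)
      separated i j _ j≤M with wrapping-range b′ j≤M
      ... | inj₁ b′≤w = gap⇒separated
        (≤-trans (s≤s (s≤s (c≤b i))) (≤-trans (subst (_≤ b′) (+-comm b 2) (+-monoʳ-≤ b 2≤x)) b′≤w))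
        (inj₁ (≤-trans 0<a′ (m≤m+n a′ _)))
      ... | inj₂ w≤a = separated-sym (gap⇒separated
        (≤-trans (s≤s (s≤s w≤a)) (≤-trans (subst (_≤ a′) (+-comm a 2) (+-monoʳ-≤ a 2≤x)) (m≤m+n a′ _)))
        (inj₂ (≤-<-trans (c≤b i) (<-≤-trans (m<m+n b 0<x) b′≤K))))

    -- Short arcs need x ≤ ℓ − 2 and long arcs need x ≥ 2; as ℓ ≥ 3, one of them is available.
    shifted-jumps-impossible : ⊥
    shifted-jumps-impossible with 2 ≤? x
    ... | yes 2≤x = doubled-hole-impossible (ℓ ∸ x) (m<n⇒0<n∸m x<ℓ) (hole-via-long-arcs 2≤x)
    ... | no  2≰x =
      doubled-hole-impossible x 0<x (hole-via-short-arcs (≤-trans (+-monoˡ-≤ 2 (≤-pred (≰⇒> 2≰x))) 3≤ℓ))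

  record AntipodalJump (u v : V) : Set where
    field
      origin : ℕ
      fits   : origin + ℓ ≤ K
      jump   : ShortJump origin (origin + ℓ) ℓ
      ends   : SamePair (at origin) (at (origin + ℓ)) u v
  open AntipodalJump

  antipodalJump : ∀ {s t L} → ShortJump s t L → s < t → t ≤ K → ¬ Neighbours K s t → Even (L + (t ∸ s)) →
                  AntipodalJump (at s) (at t)
  antipodalJump {s} J s<t t≤K ¬nb even with typeE⇒antipodal J s<t t≤K ¬nb even
  ... | refl , refl = record { origin = s ; fits = t≤K ; jump = J ; ends = inj₁ (refl , refl) }

  jump⇒antipodalJump : ∀ {a b} (P : Jump G C a b) → Short P → TypeE P → AntipodalJump (vtx C a) (vtx C b)
  jump⇒antipodalJump {a} {b} P short-P typeE-P with <-cmp (toℕ a) (toℕ b)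
  ... | tri< a<b _ _ = subst₂ AntipodalJump (at-toℕ a) (at-toℕ b)
        (antipodalJump (fromJump P short-P) a<b (Fin.toℕ≤pred[n] b) (ends-not-neighbours P)
          (subst (λ d → Even (len P + d)) (m≤n⇒∣m-n∣≡n∸m (<⇒≤ a<b)) typeE-P))
  ... | tri≈ _ a≡b _ = ⊥-elim (a≢b P (Fin.toℕ-injective a≡b))
  ... | tri> _ _ b<a = subst₂ AntipodalJump (at-toℕ a) (at-toℕ b) (swap
        (antipodalJump (shortJump-reverse (fromJump P short-P)) b<a (Fin.toℕ≤pred[n] a)
          (λ nb → ends-not-neighbours P (neighbours-sym nb))
          (subst (λ d → Even (len P + d)) (m≤n⇒∣n-m∣≡n∸m (<⇒≤ b<a)) typeE-P)))
    where
    swap : ∀ {u v} → AntipodalJump u v → AntipodalJump v u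
    swap A = record { origin = origin A ; fits = fits A ; jump = jump A ; ends = samePair-swapʳ (ends A) }

  shifted-antipodalJumps-impossible : ∀ {u v u′ v′} (A : AntipodalJump u v) (A′ : AntipodalJump u′ v′) →
                                      origin A < origin A′ → ⊥
  shifted-antipodalJumps-impossible A A′ A<A′ =
    shifted-jumps-impossible (m<n⇒0<n∸m A<A′) (subst (_≤ K) a′+ℓ≡b′ (fits A′)) (jump A)
      (subst₂ (λ s t → ShortJump s t ℓ) (sym a+x≡a′) a′+ℓ≡b′ (jump A′))
    where
    a = origin A
    x = origin A′ ∸ a
    a+x≡a′ : a + x ≡ origin A′
    a+x≡a′ = m+[n∸m]≡n (<⇒≤ A<A′)
    a′+ℓ≡b′ : origin A′ + ℓ ≡ a + ℓ + x
    a′+ℓ≡b′ = trans (cong (_+ ℓ) (sym a+x≡a′)) (+-rightComm a x ℓ)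
      where
      +-rightComm : ∀ a x ℓ → a + x + ℓ ≡ a + ℓ + x
      +-rightComm = solve-∀

  antipodalJump-unique : ∀ {u v u′ v′} (A : AntipodalJump u v) (A′ : AntipodalJump u′ v′) → origin A ≡ origin A′
  antipodalJump-unique A A′ with <-cmp (origin A) (origin A′)
  ... | tri< A<A′ _ _ = ⊥-elim (shifted-antipodalJumps-impossible A A′ A<A′)
  ... | tri≈ _ A≡A′ _ = A≡A′
  ... | tri> _ _ A′<A = ⊥-elim (shifted-antipodalJumps-impossible A′ A A′<A)

  typeE-jumps-share-ends : ∀ {a b a′ b′} (P : Jump G C a b) (P′ : Jump G C a′ b′) →
                           Short P → TypeE P → Short P′ → TypeE P′ →
                           SamePair (vtx C a) (vtx C b) (vtx C a′) (vtx C b′)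
  typeE-jumps-share-ends P P′ short-P typeE-P short-P′ typeE-P′ =
    samePair-via (ends A) (subst (λ s → SamePair (at s) (at (s + ℓ)) _ _) (sym (antipodalJump-unique A A′)) (ends A′))
    where
    A  = jump⇒antipodalJump P short-P typeE-P
    A′ = jump⇒antipodalJump P′ short-P′ typeE-P′

lemma4p1 : (ℓ : ℕ) → 3 ≤ ℓ → (n : ℕ) → (G : Graph n) →
    GirthExactly G (2 * ℓ) →
    (∀ m → Hole G m → Even m → m < 2 * ℓ + 2) →
    (k : ℕ) → (C : Hole G k) → Even k →
    (a b a′ b′ : Fin k) → (P : Jump G C a b) → (P′ : Jump G C a′ b′) →
    Short P → TypeE P → Short P′ → TypeE P′ →
    (vtx C a ≡ vtx C a′ × vtx C b ≡ vtx C b′) ⊎ (vtx C a ≡ vtx C b′ × vtx C b ≡ vtx C a′)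
lemma4p1 ℓ 3≤ℓ n G (_ , girth) noLongEvenHole zero    C _      ()
lemma4p1 ℓ 3≤ℓ n G (_ , girth) noLongEvenHole (suc K) C k-even a b a′ b′ =
  typeE-jumps-share-ends {a = a} {b} {a′} {b′}
  where
  open EvenHoles ℓ girth noLongEvenHole
  open ShortTypeEJumps ℓ 3≤ℓ girth noLongEvenHole C (evenHole-length C k-even)
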